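{- Let $T$ be a tree and $k\geq 1$. Then: (i) $T\in\mathcal{T}(S'_{2k+2})$ if and only if there exist $T_1,\dots,T_p\in\mathcal{T}^\ast$ with $p\ge2$, of height $k$, and $T_0\in\mathcal{T}^\ast$ of height $k-1$, such that $T=T_0\odot(T_1,\dots,T_p)$; (ii) $T\in\mathcal{T}(S'_{2k+3})$ if and only if there exist $T_1,\dots,T_p,T'_1,\dots,T'_q\in\mathcal{T}^\ast$ with $p,q\ge1$, of height $k$, and $T_0,T'_0\in\mathcal{T}^\ast$ of height $k-1$, such that $T=(T_0\odot(T_1,\dots,T_p))\odot(T'_0\odot(T'_1,\dots,T'_q))$; (iii) $T\in\mathcal{T}(S''_{2k+3})$ if and only if there exist $T_1,\dots,T_p,T'_0,T'_1,\dots,T'_q\in\mathcal{T}^\ast$ with $p,q\ge1$, of height $k$, and $T_0\in\mathcal{T}^\ast$ of height $k-1$, such that $T=(T_0\odot(T_1,\dots,T_p))\odot(T'_0\odot(T'_1,\dots,T'_q))$.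
   Context: Trees in $\mathcal{T}^\ast$ are considered rooted at a main root. The diameter of a tree is the maximum number of edges of a path. Main root: if $T$ has diameter $2k$, the central vertex of a longest path; if diameter $2k+1$, either endpoint of the central edge of a longest path. Height of a rooted tree: maximum distance from the root to a vertex. Operation $\odot$: for disjoint rooted trees $T_0,\dots,T_p$ ($p\ge1$) with roots $v_0,\dots,v_p$, $T_0\odot(T_1,\dots,T_p)$ is their disjoint union plus edges $v_0v_i$ ($1\le i\le p$), rooted at $v_0$; $T_0\odot T_1$ is the case $p=1$. $\mathcal{T}^\ast$: $K_1$ is the only member of height $0$; if $k,p\ge1$ and $T_0,\dots,T_p\in\mathcal{T}^\ast$, each rooted at a main root and of height $k-1$, then $T_0\odot(T_1,\dots,T_p)\in\mathcal{T}^\ast$. Seeds (rooted trees): $S_0=K_1$, $S_1=P_2$, $S_2=P_3$ rooted at centre; $S'_4=S_0\odot(S_1,S_1)$, $S'_5=(S_0\odot S_1)\odot(S_0\odot S_1)$, $S''_5=(S_0\odot S_1)\odot(S_1\odot S_1)$; for $k\ge2$: $S_{2k-1}=S_{2k-3}\odot S_{2k-3}$, $S_{2k}=S_{2k-3}\odot(S_{2k-3},S_{2k-3})$, $S'_{2k+2}=S_{2k-3}\odot(S_{2k-1},S_{2k-1})$, $S'_{2k+3}=(S_{2k-3}\odot S_{2k-1})\odot(S_{2k-3}\odot S_{2k-1})$, $S''_{2k+3}=(S_{2k-3}\odot S_{2k-1})\odot(S_{2k-1}\odot S_{2k-1})$. Unfoldings: a branch of $T$ at $v$ is a component of $T-v$,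 rooted at the neighbour of $v$; an $s$-CBD of branch $B$ at $v$ attaches $s$ disjoint copies of $B$ to $v$. For a seed $S$ of diameter $d$, $\mathcal{T}(S)$ is the set of (unlabelled) trees obtained from $S$ by finite sequences (possibly empty) of CBDs each applied to a branch at $v$ containing no main root of the current tree. -}

module Defs where

open import Data.Nat using (ℕ; zero; suc; _+_; _*_; _≤_; _⊔_)
open import Data.Bool using (Bool; true; false; not; if_then_else_)
open import Data.Fin using (Fin) renaming (_≟_ to _≟F_)
open import Data.List using (List; []; _∷_; _++_; length; lookup; replicate)
open import Data.List.Relation.Unary.All using (All)
open import Data.Product using (Σ; ∃; _×_; _,_)
open import Function.Bundles using (_↔_; Inverse)
open import Relation.Nullary using (¬_; yes; no)
open import Relation.Binary.PropositionalEquality using (_≡_; refl)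

-- A rose tree is a rooted representative of a tree; as an unlabelled
-- (unrooted) tree it is considered only up to graph isomorphism _≅_.

data RTree : Set where
  node : List RTree → RTree

data Pos : RTree → Set where
  root : ∀ {t} → Pos t
  sub  : ∀ {cs} (i : Fin (length cs)) → Pos (lookup cs i) → Pos (node cs)

depth : ∀ {t} → Pos t → ℕ
depth root      = 0
depth (sub i p) = suc (depth p)

dist : ∀ {t} → Pos t → Pos t → ℕ
dist root q = depth q
dist (sub i p) root = suc (depth p)
dist (sub i p) (sub j q) with i ≟F j
... | yes refl = dist p q
... | no _     = suc (depth p) + suc (depth q)

Adj : ∀ {t} → Pos t → Pos t → Set
Adj x y = dist x y ≡ 1

_≅_ : RTree → RTree → Set
T ≅ T' = Σ (Pos T ↔ Pos T') λ f →
           ∀ x y → (Adj x y → Adj (Inverse.to f x) (Inverse.to f y))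
                 × (Adj (Inverse.to f x) (Inverse.to f y) → Adj x y)

Longest : ∀ {t} → Pos t → Pos t → Set
Longest {t} u w = ∀ (x y : Pos t) → dist x y ≤ dist u w

-- m is a main root: m lies on a longest path u–w of length d at distance a
-- from u with a = d/2 (d even) or a ∈ {(d-1)/2, (d+1)/2} (d odd),
-- i.e. d ≤ 2a+1 and 2a ≤ d+1.
MainRoot : (t : RTree) → Pos t → Set
MainRoot t m = Σ (Pos t) λ u → Σ (Pos t) λ w →
  Longest u w
  × (dist u m + dist m w ≡ dist u w)
  × (dist u w ≤ 2 * dist u m + 1)
  × (2 * dist u m ≤ dist u w + 1)

height  : RTree → ℕ
heights : List RTree → ℕ
height (node cs) = heights cs
heights []       = 0
heights (c ∷ cs) = suc (height c) ⊔ heights cs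

_⊙_ : RTree → List RTree → RTree
node cs ⊙ ts = node (cs ++ ts)

K1 : RTree
K1 = node []

data TStar : RTree → Set where
  base : TStar K1
  step : ∀ (h : ℕ) (T₀ : RTree) (ts : List RTree) →
         TStar T₀ → height T₀ ≡ h → MainRoot T₀ root →
         All (λ t → TStar t × (height t ≡ h) × MainRoot t root) ts →
         1 ≤ length ts →
         TStar (T₀ ⊙ ts)

isEven : ℕ → Bool
isEven zero    = true
isEven (suc n) = not (isEven n)

S : ℕ → RTree
S zero = K1
S (suc zero) = K1 ⊙ (K1 ∷ [])
S (suc (suc zero)) = K1 ⊙ (K1 ∷ K1 ∷ [])
-- if n+3 = 2k-1 is odd, S_{2k-3} = S_{n+1}; if n+3 = 2k is even, S_{2k-3} = S_n
S (suc (suc (suc n))) =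
  if isEven n then S (suc n) ⊙ (S (suc n) ∷ [])
              else S n ⊙ (S n ∷ S n ∷ [])

-- S'ᵉ k = S'_{2k+2}   (k ≥ 1; the value at k = 0 is an unused junk value)
S'ᵉ : ℕ → RTree
S'ᵉ zero = K1
S'ᵉ (suc zero) = S 0 ⊙ (S 1 ∷ S 1 ∷ [])
S'ᵉ (suc (suc j)) = S (1 + 2 * j) ⊙ (S (3 + 2 * j) ∷ S (3 + 2 * j) ∷ [])
  -- k = j+2 : S_{2k-3} ⊙ (S_{2k-1}, S_{2k-1})

-- S'ᵒ k = S'_{2k+3}
S'ᵒ : ℕ → RTree
S'ᵒ zero = K1
S'ᵒ (suc zero) = (S 0 ⊙ (S 1 ∷ [])) ⊙ ((S 0 ⊙ (S 1 ∷ [])) ∷ [])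
S'ᵒ (suc (suc j)) =
  (S (1 + 2 * j) ⊙ (S (3 + 2 * j) ∷ [])) ⊙ ((S (1 + 2 * j) ⊙ (S (3 + 2 * j) ∷ [])) ∷ [])

-- S''ᵒ k = S''_{2k+3}
S''ᵒ : ℕ → RTree
S''ᵒ zero = K1
S''ᵒ (suc zero) = (S 0 ⊙ (S 1 ∷ [])) ⊙ ((S 1 ⊙ (S 1 ∷ [])) ∷ [])
S''ᵒ (suc (suc j)) =
  (S (1 + 2 * j) ⊙ (S (3 + 2 * j) ∷ [])) ⊙ ((S (3 + 2 * j) ⊙ (S (3 + 2 * j) ∷ [])) ∷ [])

-- Unfoldings 𝒯(S): closed under isomorphism (trees are unlabelled); a CBD at
-- a vertex v is performed after re-rooting at v (via isomorphism), so the
-- branches at v are exactly the child subtrees.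

data Unf (Sd : RTree) : RTree → Set where
  seed : Unf Sd Sd
  iso  : ∀ {T T'} → Unf Sd T → T ≅ T' → Unf Sd T'
  cbd  : ∀ {cs} (i : Fin (length cs)) (s : ℕ) → 1 ≤ s →
         Unf Sd (node cs) →
         ¬ (Σ (Pos (lookup cs i)) λ p → MainRoot (node cs) (sub i p)) →
         Unf Sd (node (replicate s (lookup cs i) ++ cs))

TStarH : ℕ → RTree → Set
TStarH h t = TStar t × (height t ≡ h)

{-# OPTIONS --safe #-}
-- Let minTree h be the smallest member of 𝒯* of height h, so minTree (h+1) = minTree h ⊙ minTree h
-- and S_{2h−1} = minTree h; the three seeds are minTree (k−1) ⊙ (minTree k, minTree k),
-- (minTree (k−1) ⊙ minTree k) ⊙ (minTree (k−1) ⊙ minTree k) and (minTree (k−1) ⊙ minTree k) ⊙ minTree (k+1).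
--
-- A main root m other than the root bounds the diameter by 2·height(subtree at m) + 1. The seeds
-- and all their unfoldings have diameter at least 2k+2, so a branch of height at most k never
-- contains a main root and its copies are legal CBDs. Every tree of 𝒯* of height at most k grows
-- from the minimal tree of its height by copying branches of height at most k and reordering
-- children; this gives the backward direction.
--
-- For the forward direction each seed has a shape: a description of the heights of the root's
-- children (every height below k−1 realised by complete subtrees, at least two children of height
-- at least k, and in (ii), (iii) exactly one child of height k+1, itself of a prescribed shape).
-- Shapes are invariant under isomorphism and under CBDs at a vertex v: rerooted at v, the copied
-- branch either contains the old root, which is a main root, or is a child of v, and copying it
-- keeps the shape. Complete trees, in which the children of every vertex realise all heights below
-- its own, are the members of 𝒯* up to the order of children, so a shaped tree is isomorphic to the
-- required T₀ ⊙ (T₁, …, Tₚ).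
module Submission where

open import Defs
open import Data.Bool using (true; not)
open import Data.Bool.Properties using (not-involutive)
open import Data.Empty using (⊥; ⊥-elim)
open import Data.Fin using (Fin; zero; suc) renaming (_≟_ to _≟ᶠ_)
open import Data.Fin.Properties using () renaming (suc-injective to fsuc-injective)
open import Data.List using (List; []; _∷_; _++_; [_]; length; lookup; replicate; removeAt)
open import Data.List.Membership.Propositional.Properties using (∈-lookup)
open import Data.List.Properties using (++-assoc; ++-identityʳ)
open import Data.List.Relation.Unary.All as All using (All; []; _∷_)
open import Data.List.Relation.Unary.All.Properties using (++⁺; replicate⁺)
open import Data.List.Relation.Unary.Any as Any using (Any; here; there)
open import Data.List.Relation.Unary.Any.Properties using (++⁺ˡ; ++⁺ʳ; ++⁻; lookup-index)
open import Data.Maybe using (Maybe; just; nothing)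
open import Data.Nat using (ℕ; zero; suc; pred; _+_; _*_; _≤_; _<_; _⊔_; z≤n; s≤s; _∸_; _≤?_)
open import Data.Nat.Properties
open import Data.Product using (Σ; _×_; _,_; proj₁; proj₂)
open import Data.Sum as Sum using (_⊎_; inj₁; inj₂; [_,_]′)
open import Function.Base using (_∘_)
open import Function.Bundles using (Inverse; mk↔ₛ′)
open import Relation.Binary.Bundles using (Setoid)
open import Relation.Binary.PropositionalEquality
  using (_≡_; _≢_; refl; sym; trans; cong; cong₂; subst; subst₂; module ≡-Reasoning)
import Relation.Binary.Reasoning.Setoid as SetoidReasoning
open import Relation.Nullary using (¬_; yes; no)

-- Distances and isomorphisms

dist-sub-same : ∀ {cs} (i : Fin (length cs)) (p q : Pos (lookup cs i)) →
  dist {node cs} (sub i p) (sub i q) ≡ dist p q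
dist-sub-same i p q with i ≟ᶠ i
... | yes refl = refl
... | no i≢i   = ⊥-elim (i≢i refl)

dist-sub-apart : ∀ {cs} (i j : Fin (length cs)) (p : Pos (lookup cs i)) (q : Pos (lookup cs j)) →
  i ≢ j → dist {node cs} (sub i p) (sub j q) ≡ suc (depth p) + suc (depth q)
dist-sub-apart i j p q i≢j with i ≟ᶠ j
... | yes i≡j = ⊥-elim (i≢j i≡j)
... | no _    = refl

dist-to-root : ∀ {t} (x : Pos t) → dist x root ≡ depth x
dist-to-root root      = refl
dist-to-root (sub i p) = refl

dist-self : ∀ {t} (x : Pos t) → dist x x ≡ 0
dist-self root                = refl
dist-self {node cs} (sub i p) = trans (dist-sub-same {cs} i p p) (dist-self p)

dist-sym : ∀ {t} (x y : Pos t) → dist x y ≡ dist y x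
dist-sym root y              = sym (dist-to-root y)
dist-sym (sub i p) root      = refl
dist-sym {node cs} (sub i p) (sub j q) with i ≟ᶠ j
... | yes refl = trans (dist-sym p q) (sym (dist-sub-same {cs} i q p))
... | no i≢j   = trans (+-comm (suc (depth p)) (suc (depth q)))
                       (sym (dist-sub-apart {cs} j i q p (λ j≡i → i≢j (sym j≡i))))

dist≤depth+depth : ∀ {t} (x y : Pos t) → dist x y ≤ depth x + depth y
dist≤depth+depth root y           = ≤-refl
dist≤depth+depth (sub i p) root   = ≤-reflexive (sym (+-identityʳ _))
dist≤depth+depth (sub i p) (sub j q) with i ≟ᶠ j
... | yes refl = ≤-trans (dist≤depth+depth p q) (+-mono-≤ (n≤1+n _) (n≤1+n _))
... | no _     = ≤-refl

depth≤depth+dist : ∀ {t} (y z : Pos t) → depth z ≤ depth y + dist y z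
depth≤depth+dist root z           = ≤-refl
depth≤depth+dist (sub i p) root   = z≤n
depth≤depth+dist (sub i p) (sub j q) with i ≟ᶠ j
... | yes refl = s≤s (depth≤depth+dist p q)
... | no _     = ≤-trans (m≤n+m (suc (depth q)) (suc (depth p)))
                         (+-monoʳ-≤ (suc (depth p)) (m≤n+m _ (suc (depth p))))

dist-triangle : ∀ {t} (x y z : Pos t) → dist x z ≤ dist x y + dist y z
dist-triangle root y z = depth≤depth+dist y z
dist-triangle x@(sub i p) y root = begin
  depth x                   ≤⟨ depth≤depth+dist y x ⟩
  depth y + dist y x        ≡⟨ +-comm (depth y) _ ⟩
  dist y x + depth y        ≡⟨ cong₂ _+_ (dist-sym y x) (sym (dist-to-root y)) ⟩
  dist x y + dist y root    ∎
  where open ≤-Reasoning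
dist-triangle {node cs} (sub i p) root (sub l r) = dist≤depth+depth {node cs} (sub i p) (sub l r)
dist-triangle {node cs} (sub i p) (sub j q) (sub l r) with i ≟ᶠ j | j ≟ᶠ l | i ≟ᶠ l
... | yes refl | yes refl | yes refl = dist-triangle p q r
... | yes refl | yes refl | no i≢i  = ⊥-elim (i≢i refl)
... | yes refl | no j≢j   | yes refl = ⊥-elim (j≢j refl)
... | no i≢j   | yes refl | yes refl = ⊥-elim (i≢j refl)
... | yes refl | no _     | no _     = begin
  suc (depth p) + suc (depth r)                ≤⟨ +-monoˡ-≤ (suc (depth r)) (s≤s (depth≤depth+dist q p)) ⟩
  suc (depth q + dist q p) + suc (depth r)     ≡⟨ cong (λ d → suc (depth q + d) + suc (depth r)) (dist-sym q p) ⟩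
  suc (depth q + dist p q) + suc (depth r)     ≡⟨ cong (_+ suc (depth r)) (cong suc (+-comm (depth q) _)) ⟩
  suc (dist p q + depth q) + suc (depth r)     ≡⟨ cong (_+ suc (depth r)) (sym (+-suc (dist p q) _)) ⟩
  dist p q + suc (depth q) + suc (depth r)     ≡⟨ +-assoc (dist p q) _ _ ⟩
  dist p q + (suc (depth q) + suc (depth r))   ∎
  where open ≤-Reasoning
... | no _ | yes refl | no _ = begin
  suc (depth p) + suc (depth r)                  ≤⟨ +-monoʳ-≤ (suc (depth p)) (s≤s (depth≤depth+dist q r)) ⟩
  suc (depth p) + (suc (depth q) + dist q r)     ≡⟨ sym (+-assoc (suc (depth p)) _ _) ⟩
  suc (depth p) + suc (depth q) + dist q r       ∎
  where open ≤-Reasoning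
... | no _ | no _ | yes refl = ≤-trans (dist≤depth+depth p r)
  (+-mono-≤ (≤-trans (n≤1+n _) (m≤m+n (suc (depth p)) (suc (depth q))))
            (≤-trans (n≤1+n _) (m≤n+m (suc (depth r)) (suc (depth q)))))
... | no _ | no _ | no _ =
  +-mono-≤ (m≤m+n (suc (depth p)) (suc (depth q))) (m≤n+m (suc (depth r)) (suc (depth q)))

data Walk {t : RTree} : Pos t → Pos t → ℕ → Set where
  []  : ∀ {x} → Walk x x 0
  _∷_ : ∀ {x y z n} → Adj x y → Walk y z n → Walk x z (suc n)

dist≤walk : ∀ {t} {x y : Pos t} {n} → Walk x y n → dist x y ≤ n
dist≤walk {x = x} [] = ≤-reflexive (dist-self x)
dist≤walk {x = x} {z} (_∷_ {y = y} x~y w) = begin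
  dist x z            ≤⟨ dist-triangle x y z ⟩
  dist x y + dist y z ≤⟨ +-monoʳ-≤ (dist x y) (dist≤walk w) ⟩
  dist x y + _        ≡⟨ cong (_+ _) x~y ⟩
  suc _               ∎
  where open ≤-Reasoning

_++ʷ_ : ∀ {t} {x y z : Pos t} {m n} → Walk x y m → Walk y z n → Walk x z (m + n)
[]        ++ʷ w = w
(a ∷ v)   ++ʷ w = a ∷ (v ++ʷ w)

sub-Adj : ∀ {cs} (i : Fin (length cs)) {x y} → Adj x y → Adj {node cs} (sub i x) (sub i y)
sub-Adj {cs} i {x} {y} adj = trans (dist-sub-same {cs} i x y) adj

liftWalk : ∀ {cs} (i : Fin (length cs)) {p q : Pos (lookup cs i)} {n} →
  Walk p q n → Walk {node cs} (sub i p) (sub i q) n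
liftWalk i [] = []
liftWalk {cs} i (a ∷ w) = sub-Adj {cs} i a ∷ liftWalk i w

walkFromRoot : ∀ {t} (x : Pos t) → Walk root x (depth x)
walkFromRoot root = []
walkFromRoot {node cs} (sub i p) = refl ∷ liftWalk i (walkFromRoot p)

walkToRoot : ∀ {t} (x : Pos t) → Walk x root (depth x)
walkToRoot root = []
walkToRoot {node cs} (sub i p) =
  subst (Walk (sub i p) root) (+-comm (depth p) 1) (liftWalk i (walkToRoot p) ++ʷ (refl ∷ []))

geodesic : ∀ {t} (x y : Pos t) → Walk x y (dist x y)
geodesic root y      = walkFromRoot y
geodesic (sub i p) root = walkToRoot (sub i p)
geodesic (sub i p) (sub j q) with i ≟ᶠ j
... | yes refl = liftWalk i (geodesic p q)
... | no _     = walkToRoot (sub i p) ++ʷ walkFromRoot (sub j q)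

module _ {T T′ : RTree} (f : T ≅ T′) where

  to : Pos T → Pos T′
  to = Inverse.to (proj₁ f)

  from : Pos T′ → Pos T
  from = Inverse.from (proj₁ f)

  to∘from : ∀ y → to (from y) ≡ y
  to∘from = Inverse.strictlyInverseˡ (proj₁ f)

  from∘to : ∀ x → from (to x) ≡ x
  from∘to = Inverse.strictlyInverseʳ (proj₁ f)

  ≅-Adj : ∀ {x y} → Adj x y → Adj (to x) (to y)
  ≅-Adj {x} {y} = proj₁ (proj₂ f x y)

  mapWalk : ∀ {x y n} → Walk x y n → Walk (to x) (to y) n
  mapWalk [] = []
  mapWalk (a ∷ w) = ≅-Adj a ∷ mapWalk w

  ≅-injective : ∀ {x y} → to x ≡ to y → x ≡ y
  ≅-injective {x} {y} e = trans (sym (from∘to x)) (trans (cong from e) (from∘to y))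

  ≅-dist≤ : ∀ x y → dist (to x) (to y) ≤ dist x y
  ≅-dist≤ x y = dist≤walk (mapWalk (geodesic x y))

mk≅ : ∀ {T T′} (f : Pos T → Pos T′) (g : Pos T′ → Pos T) →
  (∀ y → f (g y) ≡ y) → (∀ x → g (f x) ≡ x) → (∀ x y → dist (f x) (f y) ≡ dist x y) → T ≅ T′
mk≅ f g fg gf d = mk↔ₛ′ f g fg gf , λ x y → trans (d x y) , trans (sym (d x y))

≅-sym : ∀ {T T′} → T ≅ T′ → T′ ≅ T
≅-sym f = mk↔ₛ′ (from f) (to f) (from∘to f) (to∘from f) , λ x y →
  (λ a → proj₂ (proj₂ f (from f x) (from f y)) (subst₂ Adj (sym (to∘from f x)) (sym (to∘from f y)) a)) ,
  (λ a → subst₂ Adj (to∘from f x) (to∘from f y) (proj₁ (proj₂ f (from f x) (from f y)) a))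

-- Adjacency-preserving maps send geodesics to walks, so they cannot increase distances;
-- applied to the inverse as well, this gives equality.
≅-dist : ∀ {T T′} (f : T ≅ T′) x y → dist (to f x) (to f y) ≡ dist x y
≅-dist f x y = ≤-antisym (≅-dist≤ f x y)
  (subst₂ (λ u v → dist u v ≤ dist (to f x) (to f y)) (from∘to f x) (from∘to f y)
          (≅-dist≤ (≅-sym f) (to f x) (to f y)))

≅-refl : ∀ {T} → T ≅ T
≅-refl = mk≅ (λ x → x) (λ x → x) (λ _ → refl) (λ _ → refl) (λ _ _ → refl)

≅-trans : ∀ {T T′ T″} → T ≅ T′ → T′ ≅ T″ → T ≅ T″
≅-trans f g = mk≅ (λ x → to g (to f x)) (λ z → from f (from g z))
  (λ z → trans (cong (to g) (to∘from f (from g z))) (to∘from g z))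
  (λ x → trans (cong (from f) (from∘to g (to f x))) (from∘to f x))
  (λ x y → trans (≅-dist g (to f x) (to f y)) (≅-dist f x y))

MainRoot-≅ : ∀ {T T′} (f : T ≅ T′) {m} → MainRoot T m → MainRoot T′ (to f m)
MainRoot-≅ f {m} (u , w , longest , onPath , lower , upper) =
  to f u , to f w ,
  (λ x y → subst₂ _≤_ (dist-from x y) (sym (≅-dist f u w)) (longest (from f x) (from f y))) ,
  subst₂ _≡_ (sym (cong₂ _+_ (≅-dist f u m) (≅-dist f m w))) (sym (≅-dist f u w)) onPath ,
  subst₂ _≤_ (sym (≅-dist f u w)) (sym (cong (λ d → 2 * d + 1) (≅-dist f u m))) lower ,
  subst₂ _≤_ (sym (cong (2 *_) (≅-dist f u m))) (sym (cong (_+ 1) (≅-dist f u w))) upper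
  where
  dist-from : ∀ x y → dist (from f x) (from f y) ≡ dist x y
  dist-from x y = trans (sym (≅-dist f (from f x) (from f y))) (cong₂ dist (to∘from f x) (to∘from f y))

infix 4 _≅ᵣ_
_≅ᵣ_ : RTree → RTree → Set
T ≅ᵣ T′ = Σ (T ≅ T′) λ f → to f root ≡ root

module _ {T T′ : RTree} (f : T ≅ᵣ T′) where

  ≅ᵣ-depth : ∀ x → depth (to (proj₁ f) x) ≡ depth x
  ≅ᵣ-depth x = trans (cong (λ r → dist r (to (proj₁ f) x)) (sym (proj₂ f))) (≅-dist (proj₁ f) root x)

  ≅ᵣ-from-root : from (proj₁ f) root ≡ root
  ≅ᵣ-from-root = trans (cong (from (proj₁ f)) (sym (proj₂ f))) (from∘to (proj₁ f) root)

  ≅ᵣ-reflects-root : ∀ x → to (proj₁ f) x ≡ root → x ≡ root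
  ≅ᵣ-reflects-root x e = trans (sym (from∘to (proj₁ f) x)) (trans (cong (from (proj₁ f)) e) ≅ᵣ-from-root)

≅ᵣ-refl : ∀ {T} → T ≅ᵣ T
≅ᵣ-refl = ≅-refl , refl

≅ᵣ-trans : ∀ {A B C} → A ≅ᵣ B → B ≅ᵣ C → A ≅ᵣ C
≅ᵣ-trans (f , r) (g , r′) = ≅-trans f g , trans (cong (to g) r) r′

≅ᵣ-sym : ∀ {A B} → A ≅ᵣ B → B ≅ᵣ A
≅ᵣ-sym f = ≅-sym (proj₁ f) , ≅ᵣ-from-root f

shiftPos : ∀ {b ds} → Pos (node ds) → Pos (node (b ∷ ds))
shiftPos root      = root
shiftPos (sub j q) = sub (suc j) q

shiftPos-dist : ∀ {b ds} (x y : Pos (node ds)) → dist (shiftPos {b} x) (shiftPos {b} y) ≡ dist x y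
shiftPos-dist root root      = refl
shiftPos-dist root (sub j q) = refl
shiftPos-dist (sub j p) root = refl
shiftPos-dist (sub j p) (sub l q) with j ≟ᶠ l
... | yes refl = refl
... | no _     = refl

shiftPos-depth : ∀ {b ds} (x : Pos (node ds)) → depth (shiftPos {b} x) ≡ depth x
shiftPos-depth root      = refl
shiftPos-depth (sub j q) = refl

sub-injective : ∀ {cs} {i : Fin (length cs)} {p q : Pos (lookup cs i)} → sub {cs} i p ≡ sub i q → p ≡ q
sub-injective refl = refl

depth≡0⇒root : ∀ {t} (p : Pos t) → depth p ≡ 0 → p ≡ root
depth≡0⇒root root _ = refl

sub≢root : ∀ {cs} {i : Fin (length cs)} {p : Pos (lookup cs i)} → sub {cs} i p ≢ root
sub≢root ()

module ∷-Cong {a b cs ds} (g : a ≅ᵣ b) (h : node cs ≅ᵣ node ds) where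

  G : a ≅ b
  G = proj₁ g

  H : node cs ≅ node ds
  H = proj₁ h

  inChildren : ∀ i p → Σ (Fin (length ds)) λ j → Σ (Pos (lookup ds j)) λ q → to H (sub {cs} i p) ≡ sub j q
  inChildren i p with to H (sub i p) in eq
  ... | root    = ⊥-elim (sub≢root (≅ᵣ-reflects-root h (sub i p) eq))
  ... | sub j q = j , q , refl

  fwd : Pos (node (a ∷ cs)) → Pos (node (b ∷ ds))
  fwd root            = root
  fwd (sub zero p)    = sub zero (to G p)
  fwd (sub (suc i) p) = shiftPos (to H (sub i p))

  bwd : Pos (node (b ∷ ds)) → Pos (node (a ∷ cs))
  bwd root            = root
  bwd (sub zero q)    = sub zero (from G q)
  bwd (sub (suc j) q) = shiftPos (from H (sub j q))

  bwd∘fwd : ∀ x → bwd (fwd x) ≡ x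
  bwd∘fwd root = refl
  bwd∘fwd (sub zero p) = cong (sub zero) (from∘to G p)
  bwd∘fwd (sub (suc i) p) with inChildren i p
  ... | j , q , e rewrite e = cong shiftPos (trans (cong (from H) (sym e)) (from∘to H (sub i p)))

  fwd∘bwd : ∀ y → fwd (bwd y) ≡ y
  fwd∘bwd root = refl
  fwd∘bwd (sub zero q) = cong (sub zero) (to∘from G q)
  fwd∘bwd (sub (suc j) q) with from H (sub j q) in eq
  ... | root    = ⊥-elim (sub≢root (≅ᵣ-reflects-root (≅ᵣ-sym h) (sub j q) eq))
  ... | sub i p = cong shiftPos (trans (cong (to H) (sym eq)) (to∘from H (sub j q)))

  dist-head-tail : ∀ p i q → dist (fwd (sub zero p)) (fwd (sub (suc i) q)) ≡ dist {node (a ∷ cs)} (sub zero p) (sub (suc i) q)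
  dist-head-tail p i q with inChildren i q
  ... | j , q′ , e rewrite e = begin
    suc (depth (to G p)) + suc (depth q′)    ≡⟨ cong₂ (λ u v → suc u + v) (≅ᵣ-depth g p)
                                                  (trans (sym (cong depth e)) (≅ᵣ-depth h (sub i q))) ⟩
    suc (depth p) + suc (depth q)            ∎
    where open ≡-Reasoning

  fwd-dist : ∀ x y → dist (fwd x) (fwd y) ≡ dist x y
  fwd-dist root root = refl
  fwd-dist root (sub zero p) = cong suc (≅ᵣ-depth g p)
  fwd-dist root (sub (suc i) p) = trans (shiftPos-depth (to H (sub i p))) (≅ᵣ-depth h (sub i p))
  fwd-dist (sub zero p) root = cong suc (≅ᵣ-depth g p)
  fwd-dist (sub (suc i) p) root =
    trans (dist-to-root (fwd (sub (suc i) p))) (trans (shiftPos-depth (to H (sub i p))) (≅ᵣ-depth h (sub i p)))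
  fwd-dist (sub zero p) (sub zero q) =
    trans (dist-sub-same {b ∷ ds} zero (to G p) (to G q)) (trans (≅-dist G p q) (sym (dist-sub-same {a ∷ cs} zero p q)))
  fwd-dist (sub zero p) (sub (suc i) q) = dist-head-tail p i q
  fwd-dist (sub (suc i) q) (sub zero p) =
    trans (dist-sym (fwd (sub (suc i) q)) (fwd (sub zero p)))
          (trans (dist-head-tail p i q) (dist-sym {node (a ∷ cs)} (sub zero p) (sub (suc i) q)))
  fwd-dist (sub (suc i) p) (sub (suc j) q) =
    trans (shiftPos-dist (to H (sub i p)) (to H (sub j q)))
          (trans (≅-dist H (sub i p) (sub j q)) (sym (shiftPos-dist {a} {cs} (sub i p) (sub j q))))

  cong-∷ : node (a ∷ cs) ≅ᵣ node (b ∷ ds)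
  cong-∷ = mk≅ fwd bwd fwd∘bwd bwd∘fwd fwd-dist , refl

open ∷-Cong using (cong-∷) public

exchange : ∀ {a b cs} → Pos (node (a ∷ b ∷ cs)) → Pos (node (b ∷ a ∷ cs))
exchange root                  = root
exchange (sub zero p)          = sub (suc zero) p
exchange (sub (suc zero) p)    = sub zero p
exchange (sub (suc (suc i)) p) = sub (suc (suc i)) p

exchange-involutive : ∀ {a b cs} x → exchange {b} {a} {cs} (exchange {a} {b} x) ≡ x
exchange-involutive root                  = refl
exchange-involutive (sub zero p)          = refl
exchange-involutive (sub (suc zero) p)    = refl
exchange-involutive (sub (suc (suc i)) p) = refl

exchange-dist : ∀ {a b cs} x y → dist (exchange {a} {b} {cs} x) (exchange y) ≡ dist x y
exchange-dist root root = refl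
exchange-dist root (sub zero p) = refl
exchange-dist root (sub (suc zero) p) = refl
exchange-dist root (sub (suc (suc i)) p) = refl
exchange-dist (sub zero p) root = refl
exchange-dist (sub (suc zero) p) root = refl
exchange-dist (sub (suc (suc i)) p) root = refl
exchange-dist (sub zero p) (sub zero q) = refl
exchange-dist (sub zero p) (sub (suc zero) q) = refl
exchange-dist (sub zero p) (sub (suc (suc i)) q) = refl
exchange-dist (sub (suc zero) p) (sub zero q) = refl
exchange-dist (sub (suc zero) p) (sub (suc zero) q) = refl
exchange-dist (sub (suc zero) p) (sub (suc (suc i)) q) = refl
exchange-dist (sub (suc (suc i)) p) (sub zero q) = refl
exchange-dist (sub (suc (suc i)) p) (sub (suc zero) q) = refl
exchange-dist {a} {b} {cs} (sub (suc (suc i)) p) (sub (suc (suc j)) q) =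
  trans (shiftPos-dist {b} {a ∷ cs} (sub (suc i) p) (sub (suc j) q))
    (trans (shiftPos-dist {a} {cs} (sub i p) (sub j q))
      (sym (trans (shiftPos-dist {a} {b ∷ cs} (sub (suc i) p) (sub (suc j) q))
                  (shiftPos-dist {b} {cs} (sub i p) (sub j q)))))

swapᵣ : ∀ {a b cs} → node (a ∷ b ∷ cs) ≅ᵣ node (b ∷ a ∷ cs)
swapᵣ = mk≅ exchange exchange exchange-involutive exchange-involutive exchange-dist , refl

across : ∀ {xs ys} → Pos (node (node xs ∷ ys)) → Pos (node (node ys ∷ xs))
across root                 = sub zero root
across (sub zero root)      = root
across (sub zero (sub j p)) = sub (suc j) p
across (sub (suc i) p)      = sub zero (sub i p)

across-involutive : ∀ {xs ys} x → across {ys} {xs} (across {xs} {ys} x) ≡ x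
across-involutive root                 = refl
across-involutive (sub zero root)      = refl
across-involutive (sub zero (sub j p)) = refl
across-involutive (sub (suc i) p)      = refl

across-dist : ∀ {cs M} x y → dist (across {cs} {M} x) (across y) ≡ dist x y
across-dist root root = refl
across-dist root (sub zero root) = refl
across-dist root (sub zero (sub j p)) = refl
across-dist root (sub (suc i) p) = refl
across-dist (sub zero root) root = refl
across-dist (sub zero root) (sub zero root) = refl
across-dist (sub zero root) (sub zero (sub j p)) = refl
across-dist (sub zero root) (sub (suc i) p) = refl
across-dist (sub zero (sub j p)) root = +-comm (suc (depth p)) 1
across-dist (sub zero (sub j p)) (sub zero root) = refl
across-dist {cs} {M} (sub zero (sub j p)) (sub zero (sub l q)) = shiftPos-dist {node M} {cs} (sub j p) (sub l q)
across-dist (sub zero (sub j p)) (sub (suc i) q) = +-suc (suc (depth p)) (suc (depth q))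
across-dist (sub (suc i) p) root = refl
across-dist (sub (suc i) p) (sub zero root) = +-comm 1 (suc (depth p))
across-dist (sub (suc i) p) (sub zero (sub j q)) = sym (+-suc (suc (depth p)) (suc (depth q)))
across-dist {cs} {M} (sub (suc i) p) (sub (suc l) q) = sym (shiftPos-dist {node cs} {M} (sub i p) (sub l q))

reroot≅ : ∀ {cs M} → node (node cs ∷ M) ≅ node (node M ∷ cs)
reroot≅ = mk≅ across across across-involutive across-involutive across-dist

-- Heights and reordering of children

lookup-height : ∀ (cs : List RTree) (i : Fin (length cs)) → suc (height (lookup cs i)) ≤ heights cs
lookup-height (c ∷ cs) zero    = m≤m⊔n (suc (height c)) (heights cs)
lookup-height (c ∷ cs) (suc i) = ≤-trans (lookup-height cs i) (m≤n⊔m (suc (height c)) (heights cs))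

depth≤height : ∀ {t} (p : Pos t) → depth p ≤ height t
depth≤height root = z≤n
depth≤height {node cs} (sub i p) = ≤-trans (s≤s (depth≤height p)) (lookup-height cs i)

deepest : ∀ t → Σ (Pos t) λ p → depth p ≡ height t
deepest-child : ∀ cs → (heights cs ≡ 0) ⊎
  (Σ (Fin (length cs)) λ i → Σ (Pos (lookup cs i)) λ p → suc (depth p) ≡ heights cs)
deepest (node cs) with deepest-child cs
... | inj₁ e           = root , sym e
... | inj₂ (i , p , e) = sub i p , e
deepest-child [] = inj₁ refl
deepest-child (c ∷ cs) with ≤-total (heights cs) (suc (height c)) | deepest-child cs
... | inj₁ cs≤c | _ = inj₂ (zero , proj₁ (deepest c) ,
                             trans (cong suc (proj₂ (deepest c))) (sym (m≥n⇒m⊔n≡m cs≤c)))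
... | inj₂ c≤cs | inj₁ e = ⊥-elim (1+n≢0 (n≤0⇒n≡0 (subst (suc (height c) ≤_) e c≤cs)))
... | inj₂ c≤cs | inj₂ (i , p , e) = inj₂ (suc i , p , trans e (sym (m≤n⇒m⊔n≡n c≤cs)))

≅ᵣ-height≤ : ∀ {a b} → a ≅ᵣ b → height a ≤ height b
≅ᵣ-height≤ {a} {b} f with deepest a
... | p , e = subst (_≤ height b) (trans (≅ᵣ-depth f p) e) (depth≤height (to (proj₁ f) p))

≅ᵣ-height : ∀ {a b} → a ≅ᵣ b → height a ≡ height b
≅ᵣ-height f = ≤-antisym (≅ᵣ-height≤ f) (≅ᵣ-height≤ (≅ᵣ-sym f))

heights-++ : ∀ xs ys → heights (xs ++ ys) ≡ heights xs ⊔ heights ys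
heights-++ [] ys = refl
heights-++ (x ∷ xs) ys =
  trans (cong (suc (height x) ⊔_) (heights-++ xs ys)) (sym (⊔-assoc (suc (height x)) (heights xs) (heights ys)))

heights≤ : ∀ {m} cs → All (λ c → height c < m) cs → heights cs ≤ m
heights≤ [] [] = z≤n
heights≤ (c ∷ cs) (c<m ∷ cs<m) = ⊔-lub c<m (heights≤ cs cs<m)

heights≤-lookup : ∀ {m} cs → (∀ i → height (lookup cs i) < m) → heights cs ≤ m
heights≤-lookup []       _  = z≤n
heights≤-lookup (c ∷ cs) lt = ⊔-lub (lt zero) (heights≤-lookup cs (λ i → lt (suc i)))

heights≤⁻ : ∀ {m} cs → heights cs ≤ m → All (λ c → height c < m) cs
heights≤⁻ [] _ = []
heights≤⁻ (c ∷ cs) h≤m =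
  ≤-trans (m≤m⊔n (suc (height c)) (heights cs)) h≤m ∷ heights≤⁻ cs (≤-trans (m≤n⊔m (suc (height c)) _) h≤m)

infix 4 _≈_ _≈*_
data _≈_ : RTree → RTree → Set
data _≈*_ : List RTree → List RTree → Set
data _≈_ where
  node : ∀ {cs ds} → cs ≈* ds → node cs ≈ node ds
data _≈*_ where
  []    : [] ≈* []
  _∷_   : ∀ {a b as bs} → a ≈ b → as ≈* bs → (a ∷ as) ≈* (b ∷ bs)
  swap  : ∀ {x y as bs} → as ≈* bs → (x ∷ y ∷ as) ≈* (y ∷ x ∷ bs)
  ≈*-trans : ∀ {as bs cs} → as ≈* bs → bs ≈* cs → as ≈* cs

≈⇒≅ᵣ : ∀ {a b} → a ≈ b → a ≅ᵣ b
≈*⇒≅ᵣ : ∀ {as bs} → as ≈* bs → node as ≅ᵣ node bs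
≈⇒≅ᵣ (node l) = ≈*⇒≅ᵣ l
≈*⇒≅ᵣ [] = ≅ᵣ-refl
≈*⇒≅ᵣ (e ∷ l) = cong-∷ (≈⇒≅ᵣ e) (≈*⇒≅ᵣ l)
≈*⇒≅ᵣ (swap l) = ≅ᵣ-trans (cong-∷ ≅ᵣ-refl (cong-∷ ≅ᵣ-refl (≈*⇒≅ᵣ l))) swapᵣ
≈*⇒≅ᵣ (≈*-trans l m) = ≅ᵣ-trans (≈*⇒≅ᵣ l) (≈*⇒≅ᵣ m)

≈*⇒≅ : ∀ {as bs} → as ≈* bs → node as ≅ node bs
≈*⇒≅ l = proj₁ (≈*⇒≅ᵣ l)

≈-height : ∀ {a b} → a ≈ b → height a ≡ height b
≈-height e = ≅ᵣ-height (≈⇒≅ᵣ e)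

≈-refl : ∀ t → t ≈ t
≈*-refl : ∀ cs → cs ≈* cs
≈-refl (node cs) = node (≈*-refl cs)
≈*-refl [] = []
≈*-refl (c ∷ cs) = ≈-refl c ∷ ≈*-refl cs

≈-sym : ∀ {a b} → a ≈ b → b ≈ a
≈*-sym : ∀ {a b} → a ≈* b → b ≈* a
≈-sym (node l) = node (≈*-sym l)
≈*-sym [] = []
≈*-sym (e ∷ l) = ≈-sym e ∷ ≈*-sym l
≈*-sym (swap l) = swap (≈*-sym l)
≈*-sym (≈*-trans l m) = ≈*-trans (≈*-sym m) (≈*-sym l)

≡⇒≈* : ∀ {as bs} → as ≡ bs → as ≈* bs
≡⇒≈* {as} refl = ≈*-refl as

≈*-length : ∀ {as bs} → as ≈* bs → length as ≡ length bs
≈*-length [] = refl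
≈*-length (_ ∷ l) = cong suc (≈*-length l)
≈*-length (swap l) = cong (λ n → suc (suc n)) (≈*-length l)
≈*-length (≈*-trans l m) = trans (≈*-length l) (≈*-length m)

≈*-++ : ∀ {as bs cs ds} → as ≈* bs → cs ≈* ds → (as ++ cs) ≈* (bs ++ ds)
≈*-++ [] m = m
≈*-++ (e ∷ l) m = e ∷ ≈*-++ l m
≈*-++ (swap l) m = swap (≈*-++ l m)
≈*-++ {cs = cs} (≈*-trans l l′) m = ≈*-trans (≈*-++ l (≈*-refl cs)) (≈*-++ l′ m)

≈*-++ˡ : ∀ as {cs ds} → cs ≈* ds → (as ++ cs) ≈* (as ++ ds)
≈*-++ˡ as = ≈*-++ (≈*-refl as)

≈*-++ʳ : ∀ {as bs} cs → as ≈* bs → (as ++ cs) ≈* (bs ++ cs)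
≈*-++ʳ cs l = ≈*-++ l (≈*-refl cs)

≈*-shift : ∀ as x bs → (as ++ x ∷ bs) ≈* (x ∷ as ++ bs)
≈*-shift [] x bs = ≈*-refl _
≈*-shift (a ∷ as) x bs = ≈*-trans (≈-refl a ∷ ≈*-shift as x bs) (swap (≈*-refl _))

≈*-++-comm : ∀ as bs → (as ++ bs) ≈* (bs ++ as)
≈*-++-comm [] bs = ≡⇒≈* (sym (++-identityʳ bs))
≈*-++-comm (a ∷ as) bs = ≈*-trans (≈-refl a ∷ ≈*-++-comm as bs) (≈*-sym (≈*-shift bs a as))

≈*-setoid : Setoid _ _
≈*-setoid = record
  { Carrier = List RTree ; _≈_ = _≈*_
  ; isEquivalence = record { refl = λ {cs} → ≈*-refl cs ; sym = ≈*-sym ; trans = ≈*-trans } }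

module ≈*-Reasoning = SetoidReasoning ≈*-setoid

-- Zippers and rerooting

-- A zipper: the focused vertex is reached from the root by always entering the first child;
-- a context lists, from the root down, the remaining children met on the way.
Ctx : Set
Ctx = List (List RTree)

plugChildren : Ctx → List RTree → List RTree
plugChildren []          cs = cs
plugChildren (R ∷ ctx)   cs = node (plugChildren ctx cs) ∷ R

plug : Ctx → List RTree → RTree
plug ctx cs = node (plugChildren ctx cs)

inFocus : ∀ ctx {cs} → Pos (node cs) → Pos (plug ctx cs)
inFocus []        q = q
inFocus (R ∷ ctx) q = sub zero (inFocus ctx q)

infixr 5 _?∷_
_?∷_ : Maybe RTree → List RTree → List RTree
nothing ?∷ xs = xs
just x  ?∷ xs = x ∷ xs

-- The branch at the focus that contains the root, given the part `u` of it already built.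
upBranch : Maybe RTree → Ctx → Maybe RTree
upBranch u []        = u
upBranch u (R ∷ ctx) = upBranch (just (node (u ?∷ R))) ctx

subBelow : ∀ u {cs} (j : Fin (length cs)) → Pos (lookup cs j) → Pos (node (u ?∷ cs))
subBelow nothing  j p = sub j p
subBelow (just x) j p = sub (suc j) p

record Rerooting (ctx : Ctx) (cs : List RTree) (U : Maybe RTree) : Set where
  field
    reroot       : ∀ xs → plug ctx xs ≅ node (U ?∷ xs)
    reroot-focus : to (reroot cs) (inFocus ctx root) ≡ root
    reroot-below : ∀ j p → to (reroot cs) (inFocus ctx (sub j p)) ≡ subBelow U j p

-- Rerooting walks down the context one edge at a time; `u` is the part of the upward branch
-- built so far, carried as an extra first child of the current root.
focusWith : ∀ u ctx {cs} → Pos (node cs) → Pos (node (u ?∷ plugChildren ctx cs))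
focusWith u [] root             = root
focusWith u [] (sub j p)        = subBelow u j p
focusWith nothing (R ∷ ctx) q   = sub zero (inFocus ctx q)
focusWith (just x) (R ∷ ctx) q  = sub (suc zero) (inFocus ctx q)

focusWith-nothing : ∀ ctx {cs} (q : Pos (node cs)) → focusWith nothing ctx q ≡ inFocus ctx q
focusWith-nothing [] root      = refl
focusWith-nothing [] (sub j p) = refl
focusWith-nothing (R ∷ ctx) q  = refl

bringUp : ∀ u {P R} → node (u ?∷ P ∷ R) ≅ node (P ∷ u ?∷ R)
bringUp nothing  = ≅-refl
bringUp (just x) = proj₁ swapᵣ

bringUp-focus : ∀ u ctx {cs R} (q : Pos (node cs)) →
  to (bringUp u {node (plugChildren ctx cs)} {R}) (focusWith u (R ∷ ctx) q) ≡ sub zero (inFocus ctx q)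
bringUp-focus nothing  ctx q = refl
bringUp-focus (just x) ctx q = refl

across-focus : ∀ ctx {cs R} (q : Pos (node cs)) →
  to (reroot≅ {plugChildren ctx cs} {R}) (sub zero (inFocus ctx q)) ≡ focusWith (just (node R)) ctx q
across-focus []        root      = refl
across-focus []        (sub j p) = refl
across-focus (R′ ∷ ctx) q        = refl

Reroots : ∀ u ctx cs → node (u ?∷ plugChildren ctx cs) ≅ node (upBranch u ctx ?∷ cs) → Set
Reroots u ctx cs g = (to g (focusWith u ctx root) ≡ root)
                   × (∀ j p → to g (focusWith u ctx (sub j p)) ≡ subBelow (upBranch u ctx) j p)

rerootWith : ∀ u ctx cs → Σ (node (u ?∷ plugChildren ctx cs) ≅ node (upBranch u ctx ?∷ cs)) (Reroots u ctx cs)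
rerootWith u []        cs = ≅-refl , refl , λ j p → refl
rerootWith u (R ∷ ctx) cs with rerootWith (just (node (u ?∷ R))) ctx cs
... | g , g-root , g-sub =
  ≅-trans (bringUp u) (≅-trans reroot≅ g) , moves root g-root , λ j p → moves (sub j p) (g-sub j p)
  where
  moves : ∀ q {y} → to g (focusWith (just (node (u ?∷ R))) ctx q) ≡ y →
          to g (to reroot≅ (to (bringUp u) (focusWith u (R ∷ ctx) q))) ≡ y
  moves q e = trans (cong (λ z → to g (to reroot≅ z)) (bringUp-focus u ctx q))
                    (trans (cong (to g) (across-focus ctx q)) e)

reroot-at-focus : ∀ ctx cs → Rerooting ctx cs (upBranch nothing ctx)
reroot-at-focus ctx cs = record
  { reroot       = λ xs → proj₁ (rerootWith nothing ctx xs)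
  ; reroot-focus = trans (cong (to g) (sym (focusWith-nothing ctx root))) (proj₁ g-moves)
  ; reroot-below = λ j p → trans (cong (to g) (sym (focusWith-nothing ctx (sub j p)))) (proj₂ g-moves j p)
  }
  where
  g : plug ctx cs ≅ node (upBranch nothing ctx ?∷ cs)
  g = proj₁ (rerootWith nothing ctx cs)
  g-moves : Reroots nothing ctx cs g
  g-moves = proj₂ (rerootWith nothing ctx cs)

bring-to-front : ∀ cs (i : Fin (length cs)) →
  Σ (node cs ≅ᵣ node (lookup cs i ∷ removeAt cs i)) λ f → ∀ q → to (proj₁ f) (sub i q) ≡ sub zero q
bring-to-front (c ∷ cs) zero = ≅ᵣ-refl , λ q → refl
bring-to-front (c ∷ cs) (suc i) with bring-to-front cs i
... | f , f-sub = ≅ᵣ-trans (cong-∷ (≅ᵣ-refl {c}) f) swapᵣ , λ q → cong (λ z → exchange (shiftPos z)) (f-sub q)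

≈*-to-front : ∀ cs (i : Fin (length cs)) → cs ≈* (lookup cs i ∷ removeAt cs i)
≈*-to-front (c ∷ cs) zero = ≈*-refl _
≈*-to-front (c ∷ cs) (suc i) = ≈*-trans (≈-refl c ∷ ≈*-to-front cs i) (swap (≈*-refl _))

focus-on : ∀ t (v : Pos t) → Σ Ctx λ ctx → Σ (List RTree) λ cs →
  Σ (t ≅ᵣ plug ctx cs) λ f → (to (proj₁ f) v ≡ inFocus ctx root) × (t ≈ plug ctx cs)
focus-on (node cs) root = [] , cs , ≅ᵣ-refl , refl , ≈-refl _
focus-on (node cs) (sub i p) with focus-on (lookup cs i) p | bring-to-front cs i
... | ctx , cs′ , g , g-p , g≈ | f , f-sub =
  removeAt cs i ∷ ctx , cs′ ,
  ≅ᵣ-trans f (cong-∷ g (≅ᵣ-refl {node (removeAt cs i)})) ,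
  trans (cong (∷-Cong.fwd g (≅ᵣ-refl {node (removeAt cs i)})) (f-sub p)) (cong (sub zero) g-p) ,
  node (≈*-trans (≈*-to-front cs i) (g≈ ∷ ≈*-refl _))

-- Main roots

subtree : ∀ t → Pos t → RTree
subtree t root = t
subtree (node cs) (sub i p) = subtree (lookup cs i) p

height-subtree : ∀ t (p : Pos t) → height (subtree t p) ≤ height t
height-subtree t root = ≤-refl
height-subtree (node cs) (sub i p) =
  ≤-trans (height-subtree (lookup cs i) p) (≤-trans (n≤1+n _) (lookup-height cs i))

data InSubtree : ∀ {t} → Pos t → Pos t → Set where
  here  : ∀ {t} {x : Pos t} → InSubtree root x
  there : ∀ {cs} {i : Fin (length cs)} {m x : Pos (lookup cs i)} → InSubtree m x → InSubtree {node cs} (sub i m) (sub i x)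

inSubtree? : ∀ {t} (m x : Pos t) → InSubtree m x ⊎ ¬ InSubtree m x
inSubtree? root x = inj₁ here
inSubtree? (sub i m) root = inj₂ λ ()
inSubtree? (sub i m) (sub j x) with i ≟ᶠ j
... | no i≢j = inj₂ λ { (there _) → i≢j refl }
... | yes refl with inSubtree? m x
... | inj₁ m≽x = inj₁ (there m≽x)
... | inj₂ m⋡x = inj₂ λ { (there m≽x) → m⋡x m≽x }

dist-inSubtree : ∀ {t} {m x : Pos t} → InSubtree m x → dist x m ≤ height (subtree t m)
dist-inSubtree {x = x} here = ≤-trans (≤-reflexive (dist-to-root x)) (depth≤height x)
dist-inSubtree {node cs} (there {i = i} {m} {x} m≽x) = ≤-trans (≤-reflexive (dist-sub-same {cs} i x m)) (dist-inSubtree m≽x)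

parent : ∀ {t} → Pos t → Pos t
parentWithin : ∀ {t T} → (Pos t → Pos T) → Pos t → Pos T
parent root      = root
parent (sub i p) = parentWithin (sub i) p
parentWithin into root        = root
parentWithin into p@(sub _ _) = into (parent p)

parentWithin-sub : ∀ {t T} (into : Pos t → Pos T) (p : Pos t) → p ≢ root → parentWithin into p ≡ into (parent p)
parentWithin-sub into root p≢root = ⊥-elim (p≢root refl)
parentWithin-sub into (sub _ _) _ = refl

data RootView {t} : Pos t → Set where
  isRoot  : RootView root
  nonRoot : ∀ {p} → p ≢ root → RootView p

rootView : ∀ {t} (p : Pos t) → RootView p
rootView root      = isRoot
rootView (sub i p) = nonRoot λ ()

dist-via-parent : ∀ {t} (m : Pos t) → m ≢ root → ∀ x → ¬ InSubtree m x → dist x m ≡ suc (dist x (parent m))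
dist-via-parent root m≢root x _ = ⊥-elim (m≢root refl)
dist-via-parent {node cs} (sub i m) _ x m⋡x with rootView m
... | isRoot = outside-child x m⋡x
  where
  outside-child : ∀ (x : Pos (node cs)) → ¬ InSubtree (sub i root) x → dist x (sub i root) ≡ suc (dist x root)
  outside-child root _ = refl
  outside-child (sub j q) m⋡x with j ≟ᶠ i
  ... | yes refl = ⊥-elim (m⋡x (there here))
  ... | no _     = +-comm (suc (depth q)) 1
... | nonRoot m≢root =
  trans (via x m⋡x) (cong (λ p → suc (dist x p)) (sym (parentWithin-sub (sub {cs} i) m m≢root)))
  where
  depth-m : depth m ≡ suc (depth (parent m))
  depth-m = dist-via-parent m m≢root root λ { here → m≢root refl }
  via : ∀ (x : Pos (node cs)) → ¬ InSubtree (sub i m) x → dist x (sub i m) ≡ suc (dist x (sub i (parent m)))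
  via root _ = cong suc depth-m
  via (sub j q) m⋡x with j ≟ᶠ i
  ... | yes refl = dist-via-parent m m≢root q (λ m≽q → m⋡x (there m≽q))
  ... | no _     = trans (cong (suc (depth q) +_) (cong suc depth-m)) (+-suc (suc (depth q)) _)

-- Leaving the subtree of m on both ends, a walk through m goes through its parent twice.
dist-detour : ∀ {t} (m : Pos t) → m ≢ root → ∀ u w → ¬ InSubtree m u → ¬ InSubtree m w →
  dist u w + 2 ≤ dist u m + dist m w
dist-detour {t} m m≢root u w m⋡u m⋡w = begin
  dist u w + 2                                   ≤⟨ +-monoˡ-≤ 2 (dist-triangle u p w) ⟩
  dist u p + dist p w + 2                        ≡⟨ shuffle (dist u p) (dist p w) ⟩
  suc (dist u p) + suc (dist p w)                ≡⟨ cong₂ _+_ (sym (dist-via-parent m m≢root u m⋡u))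
                                                    (cong suc (dist-sym p w)) ⟩
  dist u m + suc (dist w p)                      ≡⟨ cong (dist u m +_) (trans (sym (dist-via-parent m m≢root w m⋡w))
                                                    (dist-sym w m)) ⟩
  dist u m + dist m w                            ∎
  where
  open ≤-Reasoning
  p : Pos t
  p = parent m
  shuffle : ∀ a b → a + b + 2 ≡ suc a + suc b
  shuffle a b = trans (+-assoc a b 2) (trans (cong (a +_) (+-comm b 2)) (+-suc a (suc b)))

-- A main root cuts a longest path into two halves differing by at most one edge, and, when it
-- is not the root, one half lies inside its subtree.
mainRoot-bound : ∀ {T} (m : Pos T) → m ≢ root → MainRoot T m → ∀ x y → dist x y ≤ 2 * height (subtree T m) + 1
mainRoot-bound {T} m m≢root (u , w , longest , onPath , lower , upper) x y = ≤-trans (longest x y) diameter≤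
  where
  h a b D : ℕ
  h = height (subtree T m)
  a = dist u m
  b = dist m w
  D = dist u w
  diameter≤ : D ≤ 2 * h + 1
  diameter≤ with inSubtree? m u | inSubtree? m w
  ... | inj₁ m≽u | _ = ≤-trans lower (+-monoˡ-≤ 1 (*-monoʳ-≤ 2 (dist-inSubtree m≽u)))
  ... | inj₂ _ | inj₁ m≽w = begin
    D               ≡⟨ sym onPath ⟩
    a + b           ≤⟨ +-monoˡ-≤ b a≤b+1 ⟩
    b + 1 + b       ≡⟨ trans (+-comm (b + 1) b) (sym (+-assoc b b 1)) ⟩
    b + b + 1       ≡⟨ cong (λ z → b + z + 1) (sym (+-identityʳ b)) ⟩
    2 * b + 1       ≤⟨ +-monoˡ-≤ 1 (*-monoʳ-≤ 2 (subst (_≤ h) (dist-sym w m) (dist-inSubtree m≽w))) ⟩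
    2 * h + 1       ∎
    where
    open ≤-Reasoning
    a≤b+1 : a ≤ b + 1
    a≤b+1 = +-cancelˡ-≤ a a (b + 1) (begin
      a + a           ≡⟨ cong (a +_) (sym (+-identityʳ a)) ⟩
      2 * a           ≤⟨ upper ⟩
      D + 1           ≡⟨ cong (_+ 1) (sym onPath) ⟩
      a + b + 1       ≡⟨ +-assoc a b 1 ⟩
      a + (b + 1)     ∎)
  ... | inj₂ m⋡u | inj₂ m⋡w =
    ⊥-elim (m+1+n≰m D (≤-trans (dist-detour m m≢root u w m⋡u m⋡w) (≤-reflexive onPath)))

-- Copying low branches of wide trees

Far : ℕ → RTree → Set
Far k T = Σ (Pos T) λ x → Σ (Pos T) λ y → 2 * k + 2 ≤ dist x y

Far-≅ : ∀ {k T T′} → T ≅ T′ → Far k T → Far k T′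
Far-≅ f (x , y , far) = to f x , to f y , subst (_ ≤_) (sym (≅-dist f x y)) far

¬MainRoot-low : ∀ {k T} → Far k T → (m : Pos T) → m ≢ root → height (subtree T m) ≤ k → ¬ MainRoot T m
¬MainRoot-low {k} (x , y , far) m m≢root low mr = m+1+n≰m (2 * k + 1) (begin
  2 * k + 1 + 1               ≡⟨ +-assoc (2 * k) 1 1 ⟩
  2 * k + 2                   ≤⟨ far ⟩
  dist x y                    ≤⟨ mainRoot-bound m m≢root mr x y ⟩
  2 * height (subtree _ m) + 1 ≤⟨ +-monoˡ-≤ 1 (*-monoʳ-≤ 2 low) ⟩
  2 * k + 1                   ∎)
  where open ≤-Reasoning

NoMainRootIn : (cs : List RTree) → Fin (length cs) → Set
NoMainRootIn cs i = ¬ (Σ (Pos (lookup cs i)) λ p → MainRoot (node cs) (sub i p))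

-- A tree of diameter at least 2k+2 has no main root in a branch of height at most k, so
-- copying such a branch is a legal CBD.
cbd-at-focus : ∀ {Sd} k ctx c cs s → 1 ≤ s → height c ≤ k → Far k (plug ctx (c ∷ cs)) →
  Unf Sd (plug ctx (c ∷ cs)) → Unf Sd (plug ctx (replicate s c ++ c ∷ cs))
cbd-at-focus {Sd} k ctx c cs s 1≤s low far u =
  cbd-below (upBranch nothing ctx) (reroot (c ∷ cs)) (reroot (replicate s c ++ c ∷ cs))
  where
  open Rerooting (reroot-at-focus ctx (c ∷ cs))
  no-mainRoot : ∀ {ds} (g : plug ctx (c ∷ cs) ≅ node ds) i → lookup ds i ≡ c → NoMainRootIn ds i
  no-mainRoot g i refl (p , mr) =
    ¬MainRoot-low {k} (Far-≅ {k} g far) (sub i p) (λ ()) (≤-trans (height-subtree c p) low) mr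
  cbd-below : ∀ U → plug ctx (c ∷ cs) ≅ node (U ?∷ c ∷ cs) →
    plug ctx (replicate s c ++ c ∷ cs) ≅ node (U ?∷ replicate s c ++ c ∷ cs) → Unf Sd (plug ctx (replicate s c ++ c ∷ cs))
  cbd-below nothing g g′ = iso (cbd zero s 1≤s (iso u g) (no-mainRoot g zero refl)) (≅-sym g′)
  cbd-below (just x) g g′ = iso (iso (cbd (suc zero) s 1≤s (iso u g) (no-mainRoot g (suc zero) refl))
                                     (≈*⇒≅ (≈*-shift (replicate s c) x (c ∷ cs))))
                                (≅-sym g′)

isTall : ℕ → RTree → ℕ
isTall k c with k ≤? height c
... | yes _ = 1
... | no _  = 0

countTall : ℕ → List RTree → ℕ
countTall k []       = 0
countTall k (c ∷ cs) = isTall k c + countTall k cs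

isTall-tall : ∀ {k c} → k ≤ height c → isTall k c ≡ 1
isTall-tall {k} {c} k≤h with k ≤? height c
... | yes _   = refl
... | no k≰h  = ⊥-elim (k≰h k≤h)

isTall-low : ∀ {k c} → height c < k → isTall k c ≡ 0
isTall-low {k} {c} h<k with k ≤? height c
... | yes k≤h = ⊥-elim (<⇒≱ h<k k≤h)
... | no _    = refl

isTall-height : ∀ {k a b} → height a ≡ height b → isTall k a ≡ isTall k b
isTall-height {k} {a} {b} e with k ≤? height a | k ≤? height b
... | yes _   | yes _   = refl
... | no _    | no _    = refl
... | yes k≤a | no k≰b  = ⊥-elim (k≰b (subst (k ≤_) e k≤a))
... | no k≰a  | yes k≤b = ⊥-elim (k≰a (subst (k ≤_) (sym e) k≤b))

isTall≤1 : ∀ k c → isTall k c ≤ 1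
isTall≤1 k c with k ≤? height c
... | yes _ = ≤-refl
... | no _  = z≤n

countTall-++ : ∀ k xs ys → countTall k (xs ++ ys) ≡ countTall k xs + countTall k ys
countTall-++ k []       ys = refl
countTall-++ k (x ∷ xs) ys = trans (cong (isTall k x +_) (countTall-++ k xs ys)) (sym (+-assoc (isTall k x) _ _))

countTall-++ˡ : ∀ k xs ys → countTall k ys ≤ countTall k (xs ++ ys)
countTall-++ˡ k xs ys = subst (countTall k ys ≤_) (sym (countTall-++ k xs ys)) (m≤n+m _ _)

countTall-≈* : ∀ k {as bs} → as ≈* bs → countTall k as ≡ countTall k bs
countTall-≈* k [] = refl
countTall-≈* k (e ∷ l) = cong₂ _+_ (isTall-height (≈-height e)) (countTall-≈* k l)
countTall-≈* k (swap {x} {y} {as} {bs} l) = begin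
  isTall k x + (isTall k y + countTall k as)   ≡⟨ sym (+-assoc (isTall k x) _ _) ⟩
  isTall k x + isTall k y + countTall k as     ≡⟨ cong₂ _+_ (+-comm (isTall k x) _) (countTall-≈* k l) ⟩
  isTall k y + isTall k x + countTall k bs     ≡⟨ +-assoc (isTall k y) _ _ ⟩
  isTall k y + (isTall k x + countTall k bs)   ∎
  where open ≡-Reasoning
countTall-≈* k (≈*-trans l m) = trans (countTall-≈* k l) (countTall-≈* k m)

countTall≤length : ∀ k xs → countTall k xs ≤ length xs
countTall≤length k []       = z≤n
countTall≤length k (x ∷ xs) = +-mono-≤ (isTall≤1 k x) (countTall≤length k xs)

countTall-low : ∀ k xs → All (λ c → height c < k) xs → countTall k xs ≡ 0
countTall-low k []       []           = refl
countTall-low k (x ∷ xs) (x<k ∷ xs<k) = cong₂ _+_ (isTall-low x<k) (countTall-low k xs xs<k)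

countTall-all-tall : ∀ k xs → All (λ c → k ≤ height c) xs → countTall k xs ≡ length xs
countTall-all-tall k []       []           = refl
countTall-all-tall k (x ∷ xs) (k≤x ∷ k≤xs) = cong₂ _+_ (isTall-tall k≤x) (countTall-all-tall k xs k≤xs)

countTall-one : ∀ k cs (i : Fin (length cs)) → k ≤ height (lookup cs i) → 1 ≤ countTall k cs
countTall-one k (c ∷ cs) zero    tall = ≤-trans (≤-reflexive (sym (isTall-tall tall))) (m≤m+n _ _)
countTall-one k (c ∷ cs) (suc i) tall = ≤-trans (countTall-one k cs i tall) (m≤n+m _ (isTall k c))

countTall-two : ∀ k cs (i j : Fin (length cs)) → i ≢ j → k ≤ height (lookup cs i) → k ≤ height (lookup cs j) →
  2 ≤ countTall k cs
countTall-two k (c ∷ cs) zero    zero    i≢j _ _ = ⊥-elim (i≢j refl)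
countTall-two k (c ∷ cs) zero    (suc j) _ ti tj =
  subst (λ n → 2 ≤ n + countTall k cs) (sym (isTall-tall ti)) (s≤s (countTall-one k cs j tj))
countTall-two k (c ∷ cs) (suc i) zero    _ ti tj =
  subst (λ n → 2 ≤ n + countTall k cs) (sym (isTall-tall tj)) (s≤s (countTall-one k cs i ti))
countTall-two k (c ∷ cs) (suc i) (suc j) i≢j ti tj =
  ≤-trans (countTall-two k cs i j (λ e → i≢j (cong suc e)) ti tj) (m≤n+m _ (isTall k c))

tall-child : ∀ k cs → 1 ≤ countTall k cs → Σ (Fin (length cs)) λ i → k ≤ height (lookup cs i)
tall-child k (c ∷ cs) one≤ with k ≤? height c
... | yes k≤c = zero , k≤c
... | no _ with tall-child k cs one≤
... | i , tall = suc i , tall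

two-tall-children : ∀ k cs → 2 ≤ countTall k cs → Σ (Fin (length cs)) λ i → Σ (Fin (length cs)) λ j →
  i ≢ j × k ≤ height (lookup cs i) × k ≤ height (lookup cs j)
two-tall-children k (c ∷ cs) two≤ with k ≤? height c
... | yes k≤c with tall-child k cs (≤-pred two≤)
... | j , tall = zero , suc j , (λ ()) , k≤c , tall
two-tall-children k (c ∷ cs) two≤ | no _ with two-tall-children k cs two≤
... | i , j , i≢j , ti , tj = suc i , suc j , (λ e → i≢j (fsuc-injective e)) , ti , tj

Wide : ℕ → RTree → Set
Wide k (node cs) = 2 ≤ countTall k cs

Wide⇒Far : ∀ k t → Wide k t → Far k t
Wide⇒Far k (node cs) wide with two-tall-children k cs wide
... | i , j , i≢j , ti , tj with deepest (lookup cs i) | deepest (lookup cs j)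
... | p , dp | q , dq = sub i p , sub j q , (begin
  2 * k + 2                     ≡⟨ cong (_+ 2) (cong (k +_) (+-identityʳ k)) ⟩
  k + k + 2                     ≡⟨ trans (+-assoc k k 2) (trans (cong (k +_) (+-comm k 2)) (+-suc k (suc k))) ⟩
  suc k + suc k                 ≤⟨ +-mono-≤ (s≤s (subst (k ≤_) (sym dp) ti)) (s≤s (subst (k ≤_) (sym dq) tj)) ⟩
  suc (depth p) + suc (depth q) ≡⟨ sym (dist-sub-apart {cs} i j p q i≢j) ⟩
  dist {node cs} (sub i p) (sub j q) ∎)
  where open ≤-Reasoning

heights-replicate : ∀ s c → heights (replicate s c) ≤ suc (height c)
heights-replicate zero    c = z≤n
heights-replicate (suc s) c = ⊔-lub ≤-refl (heights-replicate s c)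

heights-copies : ∀ s c cs → suc (height c) ≤ heights cs → heights (replicate s c ++ cs) ≡ heights cs
heights-copies s c cs c<cs = trans (heights-++ (replicate s c) cs) (m≤n⇒m⊔n≡n (≤-trans (heights-replicate s c) c<cs))

data Grows (k : ℕ) : RTree → RTree → Set where
  stay    : ∀ {a} → Grows k a a
  _⨾_     : ∀ {a b c} → Grows k a b → Grows k b c → Grows k a c
  copy    : ∀ {c cs} s → height c ≤ k → Grows k (node (c ∷ cs)) (node (replicate s c ++ c ∷ cs))
  inFirst : ∀ {c c′ cs} → Grows k c c′ → Grows k (node (c ∷ cs)) (node (c′ ∷ cs))
  reorder : ∀ {a b} → a ≈ b → Grows k a b
infixr 4 _⨾_

Grows-height : ∀ {k a b} → Grows k a b → height a ≡ height b
Grows-height stay = refl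
Grows-height (g ⨾ h) = trans (Grows-height g) (Grows-height h)
Grows-height (copy {c} {cs} s _) = sym (heights-copies s c (c ∷ cs) (m≤m⊔n _ (heights cs)))
Grows-height (inFirst {cs = cs} g) = cong (λ h → suc h ⊔ heights cs) (Grows-height g)
Grows-height (reorder e) = ≈-height e

Grows-Wide : ∀ {k a b} → Grows k a b → Wide k a → Wide k b
Grows-Wide stay w = w
Grows-Wide (g ⨾ h) w = Grows-Wide h (Grows-Wide g w)
Grows-Wide {k} (copy {c} {cs} s _) w = ≤-trans w (countTall-++ˡ k (replicate s c) (c ∷ cs))
Grows-Wide {k} (inFirst {cs = cs} g) w = subst (λ n → 2 ≤ n + countTall k cs) (isTall-height (Grows-height g)) w
Grows-Wide {k} (reorder (node l)) w = subst (2 ≤_) (countTall-≈* k l) w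

plugAt : Ctx → RTree → RTree
plugAt []        t = t
plugAt (R ∷ ctx) t = node (plugAt ctx t ∷ R)

plug≡plugAt : ∀ ctx cs → plug ctx cs ≡ plugAt ctx (node cs)
plug≡plugAt []        cs = refl
plug≡plugAt (R ∷ ctx) cs = cong (λ t → node (t ∷ R)) (plug≡plugAt ctx cs)

plugAt-deeper : ∀ ctx R c → plugAt (ctx ++ [ R ]) c ≡ plugAt ctx (node (c ∷ R))
plugAt-deeper []         R c = refl
plugAt-deeper (R′ ∷ ctx) R c = cong (λ t → node (t ∷ R′)) (plugAt-deeper ctx R c)

plugAt-height : ∀ ctx {a b} → height a ≡ height b → height (plugAt ctx a) ≡ height (plugAt ctx b)
plugAt-height []        e = e
plugAt-height (R ∷ ctx) e = cong (λ h → suc h ⊔ heights R) (plugAt-height ctx e)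

plugAt-≅ᵣ : ∀ ctx {a b} → a ≅ᵣ b → plugAt ctx a ≅ᵣ plugAt ctx b
plugAt-≅ᵣ []        f = f
plugAt-≅ᵣ (R ∷ ctx) f = cong-∷ (plugAt-≅ᵣ ctx f) (≅ᵣ-refl {node R})

Grows-Wide-plugAt : ∀ {k} ctx {a b} → Grows k a b → Wide k (plugAt ctx a) → Wide k (plugAt ctx b)
Grows-Wide-plugAt []        g w = Grows-Wide g w
Grows-Wide-plugAt {k} (R ∷ ctx) g w =
  subst (λ n → 2 ≤ n + countTall k R) (isTall-height (plugAt-height ctx (Grows-height g))) w

-- Growth is realised by CBDs: every copied branch is low, and the tree is wide hence far.
Unf-Grows : ∀ {Sd} k ctx {a b} → Grows k a b → Wide k (plugAt ctx a) → Unf Sd (plugAt ctx a) → Unf Sd (plugAt ctx b)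
Unf-Grows k ctx stay w u = u
Unf-Grows k ctx (g ⨾ h) w u = Unf-Grows k ctx h (Grows-Wide-plugAt ctx g w) (Unf-Grows k ctx g w u)
Unf-Grows k ctx (copy zero _) w u = u
Unf-Grows {Sd} k ctx (copy {c} {cs} (suc s) low) w u =
  subst (Unf Sd) (plug≡plugAt ctx (replicate (suc s) c ++ c ∷ cs))
    (cbd-at-focus k ctx c cs (suc s) (s≤s z≤n) low
      (subst (Far k) (sym (plug≡plugAt ctx (c ∷ cs))) (Wide⇒Far k _ w))
      (subst (Unf Sd) (sym (plug≡plugAt ctx (c ∷ cs))) u))
Unf-Grows {Sd} k ctx (inFirst {c} {c′} {cs} g) w u =
  subst (Unf Sd) (plugAt-deeper ctx cs c′)
    (Unf-Grows k (ctx ++ [ cs ]) g (subst (Wide k) (sym (plugAt-deeper ctx cs c)) w)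
                                   (subst (Unf Sd) (sym (plugAt-deeper ctx cs c)) u))
Unf-Grows k ctx (reorder e) w u = iso u (proj₁ (plugAt-≅ᵣ ctx (≈⇒≅ᵣ e)))

children : RTree → List RTree
children (node cs) = cs

≈*⇒Grows : ∀ {k as bs} → as ≈* bs → Grows k (node as) (node bs)
≈*⇒Grows l = reorder (node l)

≡⇒Grows : ∀ {k a b} → a ≡ b → Grows k a b
≡⇒Grows refl = stay

Grows-after : ∀ {k} P {a b} → Grows k a b → Grows k (node (P ++ children a)) (node (P ++ children b))
Grows-after P stay = stay
Grows-after P (g ⨾ h) = Grows-after P g ⨾ Grows-after P h
Grows-after P (copy {c} {cs} s low) =
  ≈*⇒Grows (≈*-shift P c cs) ⨾ copy {cs = P ++ cs} s low ⨾ ≈*⇒Grows (begin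
    replicate s c ++ c ∷ P ++ cs      ≈⟨ ≈*-++ˡ (replicate s c) (≈*-sym (≈*-shift P c cs)) ⟩
    replicate s c ++ P ++ c ∷ cs      ≡⟨ sym (++-assoc (replicate s c) P (c ∷ cs)) ⟩
    (replicate s c ++ P) ++ c ∷ cs    ≈⟨ ≈*-++ʳ (c ∷ cs) (≈*-++-comm (replicate s c) P) ⟩
    (P ++ replicate s c) ++ c ∷ cs    ≡⟨ ++-assoc P (replicate s c) (c ∷ cs) ⟩
    P ++ replicate s c ++ c ∷ cs      ∎)
  where open ≈*-Reasoning
Grows-after P (inFirst {c} {c′} {cs} g) =
  ≈*⇒Grows (≈*-shift P c cs) ⨾ inFirst {cs = P ++ cs} g ⨾ ≈*⇒Grows (≈*-sym (≈*-shift P c′ cs))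
Grows-after P (reorder (node l)) = ≈*⇒Grows (≈*-++ˡ P l)

Grows-before : ∀ {k} E {a b} → Grows k a b → Grows k (node (children a ++ E)) (node (children b ++ E))
Grows-before E stay = stay
Grows-before E (g ⨾ h) = Grows-before E g ⨾ Grows-before E h
Grows-before E (copy {c} {cs} s low) =
  copy {cs = cs ++ E} s low ⨾ ≡⇒Grows (cong node (sym (++-assoc (replicate s c) (c ∷ cs) E)))
Grows-before E (inFirst g) = inFirst g
Grows-before E (reorder (node l)) = ≈*⇒Grows (≈*-++ʳ E l)

Grows-++ : ∀ {k as bs cs ds} → Grows k (node as) (node bs) → Grows k (node cs) (node ds) →
  Grows k (node (as ++ cs)) (node (bs ++ ds))
Grows-++ {bs = bs} {cs = cs} g h = Grows-before cs g ⨾ Grows-after bs h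

Grows-pointwise : ∀ {k} m ts → All (Grows k m) ts → Grows k (node (replicate (length ts) m)) (node ts)
Grows-pointwise m []       []       = stay
Grows-pointwise m (t ∷ ts) (g ∷ gs) = inFirst g ⨾ Grows-after [ t ] (Grows-pointwise m ts gs)

replicate-+ : ∀ {A : Set} a b (x : A) → replicate a x ++ replicate b x ≡ replicate (a + b) x
replicate-+ zero    b x = refl
replicate-+ (suc a) b x = cong (x ∷_) (replicate-+ a b x)

Grows-replicate : ∀ {k} m r ts → 1 ≤ r → r ≤ length ts → height m ≤ k → All (Grows k m) ts →
  Grows k (node (replicate r m)) (node ts)
Grows-replicate m (suc r) ts _ r≤n low gs =
  copy {cs = replicate r m} (length ts ∸ suc r) low ⨾
  ≡⇒Grows (cong node (trans (replicate-+ (length ts ∸ suc r) (suc r) m)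
                            (cong (λ n → replicate n m) (m∸n+n≡m r≤n)))) ⨾
  Grows-pointwise m ts gs

-- Minimal trees

minChildren : ℕ → List RTree
minChildren zero    = []
minChildren (suc h) = minChildren h ++ [ node (minChildren h) ]

minTree : ℕ → RTree
minTree h = node (minChildren h)

heights-same : ∀ {h} ts → All (λ t → height t ≡ h) ts → 1 ≤ length ts → heights ts ≡ suc h
heights-same (t ∷ [])      (e ∷ [])  _ = trans (⊔-identityʳ _) (cong suc e)
heights-same {h} (t ∷ t′ ∷ ts) (e ∷ es) _ =
  trans (cong₂ _⊔_ (cong suc e) (heights-same (t′ ∷ ts) es (s≤s z≤n))) (⊔-idem (suc h))

height-⊙ : ∀ {h} cs₀ ts → heights cs₀ ≡ h → All (λ t → height t ≡ h) ts → 1 ≤ length ts →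
  height (node cs₀ ⊙ ts) ≡ suc h
height-⊙ {h} cs₀ ts e es len =
  trans (heights-++ cs₀ ts) (trans (cong₂ _⊔_ e (heights-same ts es len)) (m≤n⇒m⊔n≡n (n≤1+n h)))

minTree-height : ∀ h → height (minTree h) ≡ h
minTree-height zero    = refl
minTree-height (suc h) = height-⊙ (minChildren h) _ (minTree-height h) (minTree-height h ∷ []) (s≤s z≤n)

TStar-Grows : ∀ k {t} → TStar t → height t ≤ k → Grows k (minTree (height t)) t
TStar-Grows k base _ = stay
TStar-Grows k (step h (node cs₀) ts T₀∈ T₀-height _ ts∈ len) t≤k =
  subst (λ n → Grows k (minTree n) (node (cs₀ ++ ts))) (sym height≡)
    (Grows-++ (grow T₀∈ T₀-height)
              (Grows-replicate (minTree h) 1 ts (s≤s z≤n) len (≤-trans (≤-reflexive (minTree-height h)) h≤k)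
                               (grow-all ts∈)))
  where
  height≡ : height (node cs₀ ⊙ ts) ≡ suc h
  height≡ = height-⊙ cs₀ ts T₀-height (All.map (λ t∈ → proj₁ (proj₂ t∈)) ts∈) len
  h≤k : h ≤ k
  h≤k = ≤-trans (n≤1+n h) (subst (_≤ k) height≡ t≤k)
  grow : ∀ {u} → TStar u → height u ≡ h → Grows k (minTree h) u
  grow u∈ u-height = subst (λ n → Grows k (minTree n) _) u-height (TStar-Grows k u∈ (subst (_≤ k) (sym u-height) h≤k))
  grow-all : ∀ {us} → All (λ t → TStar t × height t ≡ h × MainRoot t root) us → All (Grows k (minTree h)) us
  grow-all [] = []
  grow-all ((u∈ , u-height , _) ∷ us∈) = grow u∈ u-height ∷ grow-all us∈

-- The seeds and the backward direction

2*suc : ∀ j → 2 * suc j ≡ suc (suc (2 * j))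
2*suc j = cong suc (+-suc j (j + 0))

isEven-double : ∀ j → isEven (2 * j) ≡ true
isEven-double zero    = refl
isEven-double (suc j) = trans (cong isEven (2*suc j)) (trans (not-involutive (isEven (2 * j))) (isEven-double j))

S-odd : ∀ j → S (1 + 2 * j) ≡ minTree (suc j)
S-odd zero    = refl
S-odd (suc j) = begin
  S (1 + 2 * suc j)                       ≡⟨ cong (λ n → S (suc n)) (2*suc j) ⟩
  S (3 + 2 * j)                           ≡⟨ S-step ⟩
  S (1 + 2 * j) ⊙ [ S (1 + 2 * j) ]       ≡⟨ cong (λ t → t ⊙ [ t ]) (S-odd j) ⟩
  minTree (suc (suc j))                   ∎
  where
  open ≡-Reasoning
  S-step : S (3 + 2 * j) ≡ S (1 + 2 * j) ⊙ [ S (1 + 2 * j) ]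
  S-step rewrite isEven-double j = refl

S-odd-next : ∀ j → S (3 + 2 * j) ≡ minTree (suc (suc j))
S-odd-next j = trans (cong (λ n → S (suc n)) (sym (2*suc j))) (S-odd (suc j))

seed-S′-even : ∀ k′ → S'ᵉ (suc k′) ≡ minTree k′ ⊙ (minTree (suc k′) ∷ minTree (suc k′) ∷ [])
seed-S′-even zero = refl
seed-S′-even (suc j) = cong₂ (λ a b → a ⊙ (b ∷ b ∷ [])) (S-odd j) (S-odd-next j)

seed-S′-odd : ∀ k′ → S'ᵒ (suc k′) ≡
  (minTree k′ ⊙ [ minTree (suc k′) ]) ⊙ [ minTree k′ ⊙ [ minTree (suc k′) ] ]
seed-S′-odd zero = refl
seed-S′-odd (suc j) = cong₂ (λ a b → (a ⊙ [ b ]) ⊙ [ a ⊙ [ b ] ]) (S-odd j) (S-odd-next j)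

seed-S″-odd : ∀ k′ → S''ᵒ (suc k′) ≡
  (minTree k′ ⊙ [ minTree (suc k′) ]) ⊙ [ minTree (suc k′) ⊙ [ minTree (suc k′) ] ]
seed-S″-odd zero = refl
seed-S″-odd (suc j) = cong₂ (λ a b → (a ⊙ [ b ]) ⊙ [ b ⊙ [ b ] ]) (S-odd j) (S-odd-next j)

TStarH-Grows : ∀ {k h T} → TStarH h T → h ≤ k → Grows k (minTree h) T
TStarH-Grows {k} (T∈ , refl) h≤k = TStar-Grows k T∈ h≤k

Grows-⊙ : ∀ {k h₀ r cs₀ ts} → TStarH h₀ (node cs₀) → h₀ ≤ k →
  All (TStarH k) ts → 1 ≤ r → r ≤ length ts → Grows k (minTree h₀ ⊙ replicate r (minTree k)) (node cs₀ ⊙ ts)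
Grows-⊙ {k} {r = r} {ts = ts} T₀∈ h₀≤k ts∈ 1≤r r≤n =
  Grows-++ (TStarH-Grows T₀∈ h₀≤k)
           (Grows-replicate (minTree k) r ts 1≤r r≤n (≤-reflexive (minTree-height k))
                            (All.map (λ t∈ → TStarH-Grows t∈ ≤-refl) ts∈))

Wide-last-two : ∀ k cs {a b} → k ≤ height a → k ≤ height b → Wide k (node (cs ++ a ∷ b ∷ []))
Wide-last-two k cs {a} {b} ka kb = begin
  2                                   ≡⟨ cong₂ _+_ (sym (isTall-tall ka)) (cong (_+ 0) (sym (isTall-tall kb))) ⟩
  countTall k (a ∷ b ∷ [])             ≤⟨ countTall-++ˡ k cs (a ∷ b ∷ []) ⟩
  countTall k (cs ++ a ∷ b ∷ [])       ∎
  where open ≤-Reasoning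

Unf-from-seed : ∀ {k Sd T T′} → Grows k Sd T′ → Wide k Sd → T ≅ T′ → Unf Sd T
Unf-from-seed {k} g w f = iso (Unf-Grows k [] g w seed) (≅-sym f)

minTree-tall : ∀ k → k ≤ height (minTree k)
minTree-tall k = ≤-reflexive (sym (minTree-height k))

height-last : ∀ cs a → suc (height a) ≤ height (node (cs ++ [ a ]))
height-last cs a = subst (suc (height a) ≤_) (sym (heights-++ cs [ a ]))
                         (≤-trans (m≤m⊔n _ 0) (m≤n⊔m (heights cs) _))

unfold-S′-even : ∀ k′ {T cs₀ ts} → TStarH k′ (node cs₀) → All (TStarH (suc k′)) ts → 2 ≤ length ts →
  T ≅ (node cs₀ ⊙ ts) → Unf (S'ᵉ (suc k′)) T
unfold-S′-even k′ T₀∈ ts∈ len f = Unf-from-seed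
  (subst (λ s → Grows k s _) (sym (seed-S′-even k′)) (Grows-⊙ T₀∈ (n≤1+n k′) ts∈ (s≤s z≤n) len))
  (subst (Wide k) (sym (seed-S′-even k′)) (Wide-last-two k (minChildren k′) (minTree-tall k) (minTree-tall k)))
  f
  where
  k : ℕ
  k = suc k′

-- Common shape of the seeds S′_{2k+3} (h₀′ = k - 1) and S″_{2k+3} (h₀′ = k).
unfold-⊙-⊙ : ∀ k′ h₀′ → h₀′ ≤ suc k′ → ∀ {T cs₀ ts cs₀′ ts′} →
  TStarH k′ (node cs₀) → All (TStarH (suc k′)) ts → 1 ≤ length ts →
  TStarH h₀′ (node cs₀′) → All (TStarH (suc k′)) ts′ → 1 ≤ length ts′ →
  T ≅ ((node cs₀ ⊙ ts) ⊙ [ node cs₀′ ⊙ ts′ ]) →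
  Unf ((minTree k′ ⊙ [ minTree (suc k′) ]) ⊙ [ minTree h₀′ ⊙ [ minTree (suc k′) ] ]) T
unfold-⊙-⊙ k′ h₀′ h₀′≤k T₀∈ ts∈ len T₀′∈ ts′∈ len′ f = Unf-from-seed
  (Grows-++ (Grows-⊙ T₀∈ (n≤1+n k′) ts∈ (s≤s z≤n) len)
            (inFirst (Grows-⊙ T₀′∈ h₀′≤k ts′∈ (s≤s z≤n) len′)))
  (subst (Wide k) (cong node (sym (++-assoc (minChildren k′) [ mk ] [ D ])))
         (Wide-last-two k (minChildren k′) (minTree-tall k) D-tall))
  f
  where
  k : ℕ
  k = suc k′
  mk D : RTree
  mk = minTree k
  D = minTree h₀′ ⊙ [ mk ]
  D-tall : k ≤ height D
  D-tall = ≤-trans (n≤1+n _) (≤-trans (s≤s (minTree-tall k)) (height-last (minChildren h₀′) mk))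

unfold-S′-odd : ∀ k′ {T cs₀ ts cs₀′ ts′} →
  TStarH k′ (node cs₀) → All (TStarH (suc k′)) ts → 1 ≤ length ts →
  TStarH k′ (node cs₀′) → All (TStarH (suc k′)) ts′ → 1 ≤ length ts′ →
  T ≅ ((node cs₀ ⊙ ts) ⊙ [ node cs₀′ ⊙ ts′ ]) → Unf (S'ᵒ (suc k′)) T
unfold-S′-odd k′ T₀∈ ts∈ len T₀′∈ ts′∈ len′ f =
  subst (λ s → Unf s _) (sym (seed-S′-odd k′))
        (unfold-⊙-⊙ k′ k′ (n≤1+n k′) T₀∈ ts∈ len T₀′∈ ts′∈ len′ f)

unfold-S″-odd : ∀ k′ {T cs₀ ts cs₀′ ts′} →
  TStarH k′ (node cs₀) → All (TStarH (suc k′)) ts → 1 ≤ length ts →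
  TStarH (suc k′) (node cs₀′) → All (TStarH (suc k′)) ts′ → 1 ≤ length ts′ →
  T ≅ ((node cs₀ ⊙ ts) ⊙ [ node cs₀′ ⊙ ts′ ]) → Unf (S''ᵒ (suc k′)) T
unfold-S″-odd k′ T₀∈ ts∈ len T₀′∈ ts′∈ len′ f =
  subst (λ s → Unf s _) (sym (seed-S″-odd k′))
        (unfold-⊙-⊙ k′ (suc k′) ≤-refl T₀∈ ts∈ len T₀′∈ ts′∈ len′ f)

-- Rooted isomorphisms match children

InChild : ∀ {ds} → Fin (length ds) → Pos (node ds) → Set
InChild {ds} j y = Σ (Pos (lookup ds j)) λ q → y ≡ sub j q

Adj-sub-same : ∀ {ds} {j j′ : Fin (length ds)} (q : Pos (lookup ds j)) (q′ : Pos (lookup ds j′)) →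
  Adj {node ds} (sub j q) (sub j′ q′) → j ≡ j′
Adj-sub-same {ds} {j} {j′} q q′ adj with j ≟ᶠ j′
... | yes j≡j′ = j≡j′
... | no _     = ⊥-elim (1+n≢0 (suc-injective (trans (cong suc (sym (+-suc (depth q) (depth q′)))) adj)))

InChild-Adj : ∀ {ds} {j : Fin (length ds)} {y y′ : Pos (node ds)} →
  InChild j y → Adj y y′ → y′ ≢ root → InChild j y′
InChild-Adj {y′ = root} _ _ y′≢root = ⊥-elim (y′≢root refl)
InChild-Adj {ds} {y′ = sub j′ q′} (q , refl) adj _ with Adj-sub-same {ds} q q′ adj
... | refl = q′ , refl

InChild-connected : ∀ {ds} (j : Fin (length ds)) {t} (g : Pos t → Pos (node ds)) →
  (∀ x y → Adj x y → Adj (g x) (g y)) → (∀ x → g x ≢ root) → InChild j (g root) → ∀ p → InChild j (g p)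
InChild-connected j g _ _ g-root root = g-root
InChild-connected j {node cs} g g-adj g≢root g-root (sub l p) =
  InChild-connected j (λ x → g (sub l x))
    (λ x y adj → g-adj (sub l x) (sub l y) (sub-Adj {cs} l adj)) (λ x → g≢root (sub l x))
    (InChild-Adj g-root (g-adj root (sub l root) refl) (g≢root (sub l root))) p

record ChildMatch (cs ds : List RTree) (h : node cs ≅ node ds) (i : Fin (length cs)) : Set where
  field
    j      : Fin (length ds)
    ψ      : Pos (lookup ds j) → Pos (lookup cs i)
    from-ψ : ∀ q → from h (sub j q) ≡ sub i (ψ q)
    child  : lookup cs i ≅ᵣ lookup ds j

-- Child subtrees are connected and avoid the root, so each is mapped into a single child subtree.
child-image : ∀ {cs ds} (h : node cs ≅ᵣ node ds) (i : Fin (length cs)) →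
  Σ (Fin (length ds)) λ j → ∀ p → InChild j (to (proj₁ h) (sub i p))
child-image {cs} h i with to (proj₁ h) (sub i root) in e
... | root    = ⊥-elim (sub≢root (≅ᵣ-reflects-root h (sub i root) e))
... | sub j q = j , InChild-connected j (λ x → to (proj₁ h) (sub i x)) (λ x y adj → ≅-Adj (proj₁ h) (sub-Adj {cs} i adj))
                      (λ x e → sub≢root (≅ᵣ-reflects-root h (sub i x) e)) (q , e)

match-child : ∀ {cs ds} (h : node cs ≅ᵣ node ds) (i : Fin (length cs)) → ChildMatch cs ds (proj₁ h) i
match-child {cs} {ds} (h , h-root) i = record
  { j = j ; ψ = ψ ; from-ψ = from-ψ ; child = mk≅ φ ψ φ∘ψ ψ∘φ φ-dist , φ-root }
  where
  j : Fin (length ds)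
  j = proj₁ (child-image (h , h-root) i)
  φ : Pos (lookup cs i) → Pos (lookup ds j)
  φ p = proj₁ (proj₂ (child-image (h , h-root) i) p)
  to-φ : ∀ p → to h (sub i p) ≡ sub j (φ p)
  to-φ p = proj₂ (proj₂ (child-image (h , h-root) i) p)
  φ-root : φ root ≡ root
  φ-root = depth≡0⇒root (φ root) (suc-injective (begin
    suc (depth (φ root))                  ≡⟨ cong (dist root) (sym (to-φ root)) ⟩
    dist root (to h (sub i root))         ≡⟨ cong (λ z → dist z (to h (sub i root))) (sym h-root) ⟩
    dist (to h root) (to h (sub i root))  ≡⟨ ≅-dist h root (sub i root) ⟩
    1                                     ∎))
    where open ≡-Reasoning
  preimage : ∀ q → InChild i (from h (sub j q))
  preimage = InChild-connected i (λ y → from h (sub j y)) (λ x y adj → ≅-Adj (≅-sym h) (sub-Adj {ds} j adj))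
    (λ y e → sub≢root (≅ᵣ-reflects-root (≅ᵣ-sym (h , h-root)) (sub j y) e))
    (root , trans (cong (λ z → from h (sub j z)) (sym φ-root))
                  (trans (cong (from h) (sym (to-φ root))) (from∘to h (sub i root))))
  ψ : Pos (lookup ds j) → Pos (lookup cs i)
  ψ q = proj₁ (preimage q)
  from-ψ : ∀ q → from h (sub j q) ≡ sub i (ψ q)
  from-ψ q = proj₂ (preimage q)
  ψ∘φ : ∀ p → ψ (φ p) ≡ p
  ψ∘φ p = sub-injective (trans (sym (from-ψ (φ p))) (trans (cong (from h) (sym (to-φ p))) (from∘to h (sub i p))))
  φ∘ψ : ∀ q → φ (ψ q) ≡ q
  φ∘ψ q = sub-injective (trans (sym (to-φ (ψ q))) (trans (cong (to h) (sym (from-ψ q))) (to∘from h (sub j q))))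
  φ-dist : ∀ p q → dist (φ p) (φ q) ≡ dist p q
  φ-dist p q = begin
    dist (φ p) (φ q)                            ≡⟨ sym (dist-sub-same {ds} j (φ p) (φ q)) ⟩
    dist {node ds} (sub j (φ p)) (sub j (φ q))  ≡⟨ sym (cong₂ dist (to-φ p) (to-φ q)) ⟩
    dist (to h (sub i p)) (to h (sub i q))      ≡⟨ ≅-dist h (sub i p) (sub i q) ⟩
    dist {node cs} (sub i p) (sub i q)          ≡⟨ dist-sub-same {cs} i p q ⟩
    dist p q                                    ∎
    where open ≡-Reasoning

-- Shapes

CoversBelow : ℕ → List RTree → Set
CoversBelow lev cs = ∀ l → l < lev → Any (λ c → height c ≡ l) cs

-- 𝒯* up to the order of children (see `Complete⇒TStar`).
data Complete : RTree → Set where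
  node : ∀ {cs} → All Complete cs → CoversBelow (heights cs) cs → Complete (node cs)

record Profile (G : RTree → Set) (lev top n : ℕ) (cs : List RTree) : Set where
  constructor profile
  field
    all-G  : All G cs
    covers : CoversBelow lev cs
    tall   : n ≤ countTall top cs
open Profile public

ProfileOf : (G : RTree → Set) (lev top n : ℕ) → RTree → Set
ProfileOf G lev top n (node cs) = Profile G lev top n cs

-- Shapes of the root's children for k = suc k′: a `Side` child is a child of T₀ (height < k − 1)
-- or one of T₁ … Tₚ (height k); `DeepS′`, `DeepS″` describe the last child T₀′ ⊙ (T₁′, …, T_q′)
-- in (ii) and (iii).
Side : ℕ → RTree → Set
Side k′ c = Complete c × (height c < k′ ⊎ height c ≡ suc k′)

CompleteAtMost : ℕ → RTree → Set
CompleteAtMost h c = Complete c × height c ≤ h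

DeepS′ : ℕ → RTree → Set
DeepS′ k′ c = height c ≡ suc (suc k′) × ProfileOf (Side k′) k′ (suc k′) 1 c

DeepS″ : ℕ → RTree → Set
DeepS″ k′ c = height c ≡ suc (suc k′) × ProfileOf (CompleteAtMost (suc k′)) (suc k′) (suc k′) 1 c

EvenShape : ℕ → RTree → Set
EvenShape k′ = ProfileOf (Side k′) k′ (suc k′) 2

OddShape : (RTree → Set) → ℕ → RTree → Set
OddShape Deep k′ (node cs) =
  Profile (λ c → Side k′ c ⊎ Deep c) k′ (suc k′) 2 cs × countTall (suc (suc k′)) cs ≡ 1

≈-Resp : (RTree → Set) → Set
≈-Resp P = ∀ {a b} → a ≈ b → P a → P b

All-≈* : ∀ {P} → ≈-Resp P → ∀ {cs ds} → cs ≈* ds → All P cs → All P ds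
All-≈* resp [] [] = []
All-≈* resp (e ∷ l) (p ∷ ps) = resp e p ∷ All-≈* resp l ps
All-≈* resp (swap l) (p ∷ q ∷ ps) = q ∷ p ∷ All-≈* resp l ps
All-≈* resp (≈*-trans l l′) ps = All-≈* resp l′ (All-≈* resp l ps)

Any-≈* : ∀ {P} → ≈-Resp P → ∀ {cs ds} → cs ≈* ds → Any P cs → Any P ds
Any-≈* resp (e ∷ l) (here p) = here (resp e p)
Any-≈* resp (e ∷ l) (there a) = there (Any-≈* resp l a)
Any-≈* resp (swap l) (here p) = there (here p)
Any-≈* resp (swap l) (there (here p)) = here p
Any-≈* resp (swap l) (there (there a)) = there (there (Any-≈* resp l a))
Any-≈* resp (≈*-trans l l′) a = Any-≈* resp l′ (Any-≈* resp l a)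

height-resp : ∀ (P : ℕ → Set) → ≈-Resp (λ c → P (height c))
height-resp P e = subst P (≈-height e)

CoversBelow-≈* : ∀ {lev cs ds} → cs ≈* ds → CoversBelow lev cs → CoversBelow lev ds
CoversBelow-≈* l cov n n<lev = Any-≈* (height-resp (_≡ n)) l (cov n n<lev)

Complete-≈ : ≈-Resp Complete
All-Complete-≈* : ∀ {cs ds} → cs ≈* ds → All Complete cs → All Complete ds
Complete-≈ (node l) (node cs∈ cov) =
  node (All-Complete-≈* l cs∈) (CoversBelow-≈* l (subst (λ h → CoversBelow h _) (≈-height (node l)) cov))
All-Complete-≈* [] [] = []
All-Complete-≈* (e ∷ l) (p ∷ ps) = Complete-≈ e p ∷ All-Complete-≈* l ps
All-Complete-≈* (swap l) (p ∷ q ∷ ps) = q ∷ p ∷ All-Complete-≈* l ps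
All-Complete-≈* (≈*-trans l l′) ps = All-Complete-≈* l′ (All-Complete-≈* l ps)

Profile-≈* : ∀ {G lev top n cs ds} → ≈-Resp G → cs ≈* ds → Profile G lev top n cs → Profile G lev top n ds
Profile-≈* {top = top} resp l (profile a cov t) =
  profile (All-≈* resp l a) (CoversBelow-≈* l cov) (subst (_ ≤_) (countTall-≈* top l) t)

ProfileOf-≈ : ∀ {G lev top n} → ≈-Resp G → ≈-Resp (ProfileOf G lev top n)
ProfileOf-≈ resp (node l) = Profile-≈* resp l

Side-≈ : ∀ {k′} → ≈-Resp (Side k′)
Side-≈ {k′} e (c , h) = Complete-≈ e c , Sum.map (height-resp (_< k′) e) (height-resp (_≡ suc k′) e) h

CompleteAtMost-≈ : ∀ {h} → ≈-Resp (CompleteAtMost h)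
CompleteAtMost-≈ {h} e (c , c≤h) = Complete-≈ e c , height-resp (_≤ h) e c≤h

DeepS′-≈ : ∀ {k′} → ≈-Resp (DeepS′ k′)
DeepS′-≈ {k′} e (h , p) = height-resp (_≡ suc (suc k′)) e h , ProfileOf-≈ Side-≈ e p

DeepS″-≈ : ∀ {k′} → ≈-Resp (DeepS″ k′)
DeepS″-≈ {k′} e (h , p) = height-resp (_≡ suc (suc k′)) e h , ProfileOf-≈ CompleteAtMost-≈ e p

EvenShape-≈ : ∀ {k′} → ≈-Resp (EvenShape k′)
EvenShape-≈ = ProfileOf-≈ Side-≈

OddShape-≈ : ∀ {Deep} → ≈-Resp Deep → ∀ {k′} → ≈-Resp (OddShape Deep k′)
OddShape-≈ resp {k′} (node l) (p , one) =
  Profile-≈* (λ e → Sum.map (Side-≈ e) (resp e)) l p , trans (sym (countTall-≈* (suc (suc k′)) l)) one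

heights-copy-child : ∀ s cs (j : Fin (length cs)) → heights (replicate s (lookup cs j) ++ cs) ≡ heights cs
heights-copy-child s cs j = heights-copies s (lookup cs j) cs (lookup-height cs j)

heights-copy-at : ∀ ctx cs (j : Fin (length cs)) s →
  heights (plugChildren ctx (replicate s (lookup cs j) ++ cs)) ≡ heights (plugChildren ctx cs)
heights-copy-at []        cs j s = heights-copy-child s cs j
heights-copy-at (R ∷ ctx) cs j s = cong (λ h → suc h ⊔ heights R) (heights-copy-at ctx cs j s)

CopyClosed : (RTree → Set) → Set
CopyClosed G = ∀ ctx cs (j : Fin (length cs)) s → G (plug ctx cs) → G (plug ctx (replicate s (lookup cs j) ++ cs))

CoversBelow-copy : ∀ {lev} cs xs → CoversBelow lev cs → CoversBelow lev (xs ++ cs)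
CoversBelow-copy cs xs cov l l<lev = ++⁺ʳ xs (cov l l<lev)

Any-head : ∀ {l X X′ R} → height X ≡ height X′ →
  Any (λ c → height c ≡ l) (X ∷ R) → Any (λ c → height c ≡ l) (X′ ∷ R)
Any-head e (here p)  = here (trans (sym e) p)
Any-head e (there a) = there a

Profile-copy : ∀ {G lev top n cs} → Profile G lev top n cs → (j : Fin (length cs)) → ∀ s →
  Profile G lev top n (replicate s (lookup cs j) ++ cs)
Profile-copy {top = top} {cs = cs} (profile a cov t) j s =
  profile (++⁺ (replicate⁺ s (All.lookup a (∈-lookup j))) a) (CoversBelow-copy cs _ cov)
          (≤-trans t (countTall-++ˡ top (replicate s (lookup cs j)) cs))

Profile-head : ∀ {G lev top n X X′ R} → height X ≡ height X′ → G X′ →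
  Profile G lev top n (X ∷ R) → Profile G lev top n (X′ ∷ R)
Profile-head {top = top} {R = R} e g (profile (_ ∷ a) cov t) =
  profile (g ∷ a) (λ l l<lev → Any-head e (cov l l<lev)) (subst (λ m → _ ≤ m + countTall top R) (isTall-height e) t)

ProfileOf-copy : ∀ {G lev top n} → CopyClosed G → CopyClosed (ProfileOf G lev top n)
ProfileOf-copy G-copy []        cs j s p = Profile-copy p j s
ProfileOf-copy G-copy (R ∷ ctx) cs j s p@(profile (g ∷ _) _ _) =
  Profile-head (sym (heights-copy-at ctx cs j s)) (G-copy ctx cs j s g) p

Complete-copy : CopyClosed Complete
Complete-copy [] cs j s (node a cov) =
  node (++⁺ (replicate⁺ s (All.lookup a (∈-lookup j))) a)
       (CoversBelow-copy cs _ (subst (λ h → CoversBelow h cs) (sym (heights-copy-child s cs j)) cov))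
Complete-copy (R ∷ ctx) cs j s (node (c ∷ a) cov) =
  node (Complete-copy ctx cs j s c ∷ a)
       (λ l l<h → Any-head (sym (heights-copy-at ctx cs j s))
                           (cov l (subst (l <_) (cong (λ h → suc h ⊔ heights R) (heights-copy-at ctx cs j s)) l<h)))

Side-copy : ∀ {k′} → CopyClosed (Side k′)
Side-copy ctx cs j s (c , h) =
  Complete-copy ctx cs j s c , subst (λ m → (m < _) ⊎ (m ≡ _)) (sym (heights-copy-at ctx cs j s)) h

CompleteAtMost-copy : ∀ {h} → CopyClosed (CompleteAtMost h)
CompleteAtMost-copy ctx cs j s (c , c≤h) = Complete-copy ctx cs j s c , subst (_≤ _) (sym (heights-copy-at ctx cs j s)) c≤h

DeepS′-copy : ∀ {k′} → CopyClosed (DeepS′ k′)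
DeepS′-copy ctx cs j s (h , p) = trans (heights-copy-at ctx cs j s) h , ProfileOf-copy Side-copy ctx cs j s p

DeepS″-copy : ∀ {k′} → CopyClosed (DeepS″ k′)
DeepS″-copy ctx cs j s (h , p) = trans (heights-copy-at ctx cs j s) h , ProfileOf-copy CompleteAtMost-copy ctx cs j s p

EvenShape-copy : ∀ {k′} → CopyClosed (EvenShape k′)
EvenShape-copy = ProfileOf-copy Side-copy

OddShape-copy : ∀ {Deep} → CopyClosed Deep → ∀ {k′} ctx cs (j : Fin (length cs)) s →
  (ctx ≡ [] → height (lookup cs j) ≤ suc k′) →
  OddShape Deep k′ (plug ctx cs) → OddShape Deep k′ (plug ctx (replicate s (lookup cs j) ++ cs))
OddShape-copy Deep-copy {k′} [] cs j s low (p , one) =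
  Profile-copy p j s ,
  trans (countTall-++ K (replicate s (lookup cs j)) cs)
        (trans (cong (_+ countTall K cs) (countTall-low K _ (replicate⁺ s (s≤s (low refl))))) one)
  where
  K : ℕ
  K = suc (suc k′)
OddShape-copy Deep-copy {k′} (R ∷ ctx) cs j s _ (p@(profile (g ∷ _) _ _) , one) =
  Profile-head (sym (heights-copy-at ctx cs j s)) (Sum.map (Side-copy ctx cs j s) (Deep-copy ctx cs j s) g) p ,
  trans (cong (_+ countTall (suc (suc k′)) R) (isTall-height (heights-copy-at ctx cs j s))) one

-- Main roots of shaped trees

MainRoot-balanced : ∀ {t} {u w m : Pos t} → Longest u w → dist u m + dist m w ≡ dist u w →
  dist m w ≤ dist u m + 1 → dist u m ≤ dist m w + 1 → MainRoot t m
MainRoot-balanced {u = u} {w} {m} longest onPath b≤a+1 a≤b+1 = u , w , longest , onPath ,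
  (begin
    dist u w               ≡⟨ sym onPath ⟩
    a + b                  ≤⟨ +-monoʳ-≤ a b≤a+1 ⟩
    a + (a + 1)            ≡⟨ sym (+-assoc a a 1) ⟩
    a + a + 1              ≡⟨ cong (λ z → a + z + 1) (sym (+-identityʳ a)) ⟩
    2 * a + 1              ∎) ,
  (begin
    2 * a                  ≡⟨ cong (a +_) (+-identityʳ a) ⟩
    a + a                  ≤⟨ +-monoʳ-≤ a a≤b+1 ⟩
    a + (b + 1)            ≡⟨ sym (+-assoc a b 1) ⟩
    a + b + 1              ≡⟨ cong (_+ 1) onPath ⟩
    dist u w + 1           ∎)
  where
  open ≤-Reasoning
  a b : ℕ
  a = dist u m
  b = dist m w

dist≤2heights : ∀ {cs} (x y : Pos (node cs)) → dist x y ≤ heights cs + heights cs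
dist≤2heights {cs} x y = ≤-trans (dist≤depth+depth x y) (+-mono-≤ (depth≤height x) (depth≤height y))

deepest-depth : ∀ {c h} → height c ≡ h → depth (proj₁ (deepest c)) ≡ h
deepest-depth e = trans (proj₂ (deepest _)) e

MainRoot-two-tallest : ∀ h cs → All (λ c → height c ≤ h) cs → 2 ≤ countTall h cs → MainRoot (node cs) root
MainRoot-two-tallest h cs low two with two-tall-children h cs two
... | i , j , i≢j , ti , tj = MainRoot-balanced {u = sub i p} {w = sub j q} longest
  (sym (dist-sub-apart {cs} i j p q i≢j))
  (≤-trans (≤-reflexive (cong suc (trans dq (sym dp)))) (m≤m+n _ 1))
  (≤-trans (≤-reflexive (cong suc (trans dp (sym dq)))) (m≤m+n _ 1))
  where
  exact : ∀ i → h ≤ height (lookup cs i) → height (lookup cs i) ≡ h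
  exact i t = ≤-antisym (All.lookup low (∈-lookup i)) t
  p : Pos (lookup cs i)
  p = proj₁ (deepest (lookup cs i))
  q : Pos (lookup cs j)
  q = proj₁ (deepest (lookup cs j))
  dp : depth p ≡ h
  dp = deepest-depth (exact i ti)
  dq : depth q ≡ h
  dq = deepest-depth (exact j tj)
  longest : Longest {node cs} (sub i p) (sub j q)
  longest x y = ≤-trans (dist≤2heights x y) (≤-trans (+-mono-≤ hs≤ hs≤) (≤-reflexive (sym (trans
    (dist-sub-apart {cs} i j p q i≢j) (cong₂ _+_ (cong suc dp) (cong suc dq))))))
    where
    hs≤ : heights cs ≤ suc h
    hs≤ = heights≤ cs (All.map s≤s low)

module UniqueTallest (h : ℕ) (cs : List RTree) (iD : Fin (length cs)) (iD-height : height (lookup cs iD) ≡ suc h)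
                     (others : ∀ i → i ≢ iD → height (lookup cs i) ≤ h)
                     (j : Fin (length cs)) (j≢iD : j ≢ iD) (j-tall : h ≤ height (lookup cs j)) where

  child≤ : ∀ i → height (lookup cs i) ≤ suc h
  child≤ i with i ≟ᶠ iD
  ... | yes refl = ≤-reflexive iD-height
  ... | no i≢iD  = ≤-trans (others i i≢iD) (n≤1+n h)

  D : ℕ
  D = suc (suc h) + suc h

  heights≤D : heights cs ≤ D
  heights≤D = ≤-trans (heights≤-lookup cs (λ i → s≤s (child≤ i))) (m≤m+n _ _)

  depth≤ : ∀ a (x : Pos (lookup cs a)) → depth x ≤ suc h
  depth≤ a x = ≤-trans (depth≤height x) (child≤ a)

  depth≤-other : ∀ a → a ≢ iD → (x : Pos (lookup cs a)) → depth x ≤ h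
  depth≤-other a a≢iD x = ≤-trans (depth≤height x) (others a a≢iD)

  longest-bound : ∀ (x y : Pos (node cs)) → dist x y ≤ D
  longest-bound root y = ≤-trans (depth≤height y) heights≤D
  longest-bound (sub a x) root = ≤-trans (depth≤height (sub {cs} a x)) heights≤D
  longest-bound (sub a x) (sub b y) with a ≟ᶠ b
  ... | yes refl = ≤-trans (dist≤depth+depth x y) (+-mono-≤ (≤-trans (depth≤ a x) (n≤1+n _)) (depth≤ a y))
  ... | no a≢b with a ≟ᶠ iD
  ...   | yes refl = +-mono-≤ (s≤s (depth≤ a x)) (s≤s (depth≤-other b (λ e → a≢b (sym e)) y))
  ...   | no a≢iD  = ≤-trans (+-mono-≤ (s≤s (depth≤-other a a≢iD x)) (s≤s (depth≤ b y)))
                             (≤-reflexive (+-comm (suc h) (suc (suc h))))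

  p : Pos (lookup cs iD)
  p = proj₁ (deepest (lookup cs iD))
  q : Pos (lookup cs j)
  q = proj₁ (deepest (lookup cs j))
  dp : depth p ≡ suc h
  dp = deepest-depth iD-height
  dq : depth q ≡ h
  dq = deepest-depth (≤-antisym (others j j≢iD) j-tall)

  u w : Pos (node cs)
  u = sub iD p
  w = sub j q

  u-w : dist u w ≡ D
  u-w = trans (dist-sub-apart {cs} iD j p q (λ e → j≢iD (sym e))) (cong₂ (λ x y → suc x + suc y) dp dq)

  longest : Longest u w
  longest x y = subst (_ ≤_) (sym u-w) (longest-bound x y)

  iD≢j : iD ≢ j
  iD≢j e = j≢iD (sym e)

  MainRoot-root : MainRoot (node cs) root
  MainRoot-root = MainRoot-balanced {u = u} {w} longest (sym (dist-sub-apart {cs} iD j p q iD≢j))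
    (subst₂ (λ x y → suc y ≤ suc x + 1) (sym dp) (sym dq) (≤-trans (n≤1+n _) (m≤m+n _ 1)))
    (subst₂ (λ x y → suc x ≤ suc y + 1) (sym dp) (sym dq) (≤-reflexive (+-comm 1 (suc h))))

  MainRoot-deep : MainRoot (node cs) (sub iD root)
  MainRoot-deep = MainRoot-balanced {u = u} {w} longest
    (begin
      dist u (sub iD root) + dist (sub iD root) w   ≡⟨ cong₂ _+_ (trans (dist-sub-same {cs} iD p root) (dist-to-root p))
                                                                 (dist-sub-apart {cs} iD j root q iD≢j) ⟩
      depth p + suc (suc (depth q))                 ≡⟨ +-suc (depth p) _ ⟩
      suc (depth p + suc (depth q))                 ≡⟨ sym (dist-sub-apart {cs} iD j p q iD≢j) ⟩
      dist u w                                      ∎)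
    (subst₂ (λ a b → b ≤ a + 1) (sym a≡) (sym b≡) (≤-reflexive (+-comm 1 (suc h))))
    (subst₂ (λ a b → a ≤ b + 1) (sym a≡) (sym b≡) (≤-trans (n≤1+n _) (m≤m+n _ 1)))
    where
    open ≡-Reasoning
    a≡ : dist u (sub iD root) ≡ suc h
    a≡ = trans (dist-sub-same {cs} iD p root) (trans (dist-to-root p) dp)
    b≡ : dist (sub iD root) w ≡ suc (suc h)
    b≡ = trans (dist-sub-apart {cs} iD j root q iD≢j) (cong (λ z → suc (suc z)) dq)

MainRoot-covering : ∀ h cs → heights cs ≡ suc h → CoversBelow (suc h) cs → (h ≡ 0 → 2 ≤ countTall 0 cs) →
  MainRoot (node cs) root
MainRoot-covering h cs hs cov not-edge with 2 ≤? countTall h cs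
... | yes two = MainRoot-two-tallest h cs (All.map ≤-pred (heights≤⁻ cs (≤-reflexive hs))) two
MainRoot-covering zero cs hs cov not-edge | no ¬two = ⊥-elim (¬two (not-edge refl))
MainRoot-covering (suc h) cs hs cov not-edge | no ¬two =
  UniqueTallest.MainRoot-root h cs iD iD-height others j j≢iD (≤-reflexive (sym j-height))
  where
  iD : Fin (length cs)
  iD = Any.index (cov (suc h) ≤-refl)
  iD-height : height (lookup cs iD) ≡ suc h
  iD-height = lookup-index (cov (suc h) ≤-refl)
  j : Fin (length cs)
  j = Any.index (cov h (n≤1+n _))
  j-height : height (lookup cs j) ≡ h
  j-height = lookup-index (cov h (n≤1+n _))
  j≢iD : j ≢ iD
  j≢iD e = 1+n≢n (trans (sym iD-height) (trans (cong (λ i → height (lookup cs i)) (sym e)) j-height))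
  others : ∀ i → i ≢ iD → height (lookup cs i) ≤ h
  others i i≢iD with suc (height (lookup cs i)) ≤? suc h
  ... | yes lt = ≤-pred lt
  ... | no ¬lt = ⊥-elim (¬two (countTall-two (suc h) cs i iD i≢iD (≮⇒≥ ¬lt) (≤-reflexive (sym iD-height))))

MainRoot-edge : MainRoot (node [ K1 ]) root
MainRoot-edge = MainRoot-balanced {u = sub zero root} {w = root} longest refl z≤n ≤-refl
  where
  longest : Longest {node [ K1 ]} (sub zero root) root
  longest root            root            = z≤n
  longest root            (sub zero root) = ≤-refl
  longest (sub zero root) root            = ≤-refl
  longest (sub zero root) (sub zero root) = z≤n

Complete-MainRoot : ∀ {t} → Complete t → MainRoot t root
Complete-MainRoot {node []} _ = root , root , (λ { root root → z≤n }) , refl , z≤n , z≤n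
Complete-MainRoot {node (node [] ∷ [])} _ = MainRoot-edge
Complete-MainRoot {node (c@(node (x ∷ xs)) ∷ [])} (node _ cov) =
  MainRoot-covering (height c) (c ∷ []) hs (subst (λ h → CoversBelow h (c ∷ [])) hs cov) (λ c-leaf → ⊥-elim (c-inner c-leaf))
  where
  hs : heights (c ∷ []) ≡ suc (height c)
  hs = ⊔-identityʳ _
  c-inner : height c ≢ 0
  c-inner h≡0 = 1+n≢0 (n≤0⇒n≡0 (subst (suc (height x) ≤_) h≡0 (m≤m⊔n (suc (height x)) (heights xs))))
Complete-MainRoot {node cs@(c₀ ∷ c₁ ∷ cs′)} (node _ cov) =
  MainRoot-covering _ cs hs (subst (λ h → CoversBelow h cs) hs cov) (λ _ → countTall-two 0 cs zero (suc zero) (λ ()) z≤n z≤n)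
  where
  suc-⊔ : ∀ a b → suc a ⊔ b ≡ suc (a ⊔ pred b)
  suc-⊔ a zero    = cong suc (sym (⊔-identityʳ a))
  suc-⊔ a (suc b) = refl
  hs : heights cs ≡ suc (height c₀ ⊔ pred (heights (c₁ ∷ cs′)))
  hs = suc-⊔ (height c₀) (heights (c₁ ∷ cs′))

-- The properties of a shape that make it invariant under unfolding (k = suc k′).
record Invariant (k′ : ℕ) (Shape : RTree → Set) : Set₁ where
  field
    resp-≈   : ≈-Resp Shape
    copyable : ∀ ctx cs (j : Fin (length cs)) s → (ctx ≡ [] → ¬ MainRoot (node cs) (sub j root)) →
               Shape (plug ctx cs) → Shape (plug ctx (replicate s (lookup cs j) ++ cs))
    mainRoot : ∀ {t} → Shape t → MainRoot t root
    wide     : ∀ {t} → Shape t → Wide (suc k′) t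
    low      : ∀ {cs} → Shape (node cs) → All (λ c → height c ≤ suc (suc k′)) cs

Side-height : ∀ {k′ c} → Side k′ c → height c ≤ suc k′
Side-height (_ , inj₁ c<k′) = ≤-trans (<⇒≤ c<k′) (n≤1+n _)
Side-height (_ , inj₂ c≡k)  = ≤-reflexive c≡k

EvenShape-Invariant : ∀ k′ → Invariant k′ (EvenShape k′)
EvenShape-Invariant k′ = record
  { resp-≈   = EvenShape-≈
  ; copyable = λ ctx cs j s _ → EvenShape-copy ctx cs j s
  ; mainRoot = λ { {node cs} shape → MainRoot-two-tallest (suc k′) cs (All.map Side-height (all-G shape)) (tall shape) }
  ; wide     = λ { {node cs} shape → tall shape }
  ; low      = λ shape → All.map (λ side → ≤-trans (Side-height side) (n≤1+n _)) (all-G shape)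
  }

module OddShapeRoots {Deep : RTree → Set} (k′ : ℕ) (Deep-height : ∀ {c} → Deep c → height c ≡ suc (suc k′))
                     (cs : List RTree) (shape : OddShape Deep k′ (node cs)) where

  K : ℕ
  K = suc (suc k′)

  profile-of : Profile (λ c → Side k′ c ⊎ Deep c) k′ (suc k′) 2 cs
  profile-of = proj₁ shape

  one-deep : countTall K cs ≡ 1
  one-deep = proj₂ shape

  children≤ : All (λ c → height c ≤ K) cs
  children≤ = All.map [ (λ side → ≤-trans (Side-height side) (n≤1+n _)) , (λ deep → ≤-reflexive (Deep-height deep)) ]′
                      (all-G profile-of)

  iD : Fin (length cs)
  iD = proj₁ (tall-child K cs (≤-reflexive (sym one-deep)))

  iD-height : height (lookup cs iD) ≡ K
  iD-height = ≤-antisym (All.lookup children≤ (∈-lookup iD)) (proj₂ (tall-child K cs (≤-reflexive (sym one-deep))))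

  others : ∀ i → i ≢ iD → height (lookup cs i) ≤ suc k′
  others i i≢iD with suc (height (lookup cs i)) ≤? K
  ... | yes lt = ≤-pred lt
  ... | no ¬lt = ⊥-elim (1+n≰n (≤-trans (countTall-two K cs i iD i≢iD (≮⇒≥ ¬lt) (≤-reflexive (sym iD-height)))
                                        (≤-reflexive one-deep)))

  second : Σ (Fin (length cs)) λ j → j ≢ iD × suc k′ ≤ height (lookup cs j)
  second with two-tall-children (suc k′) cs (tall profile-of)
  ... | i₁ , i₂ , i₁≢i₂ , t₁ , t₂ with i₁ ≟ᶠ iD
  ...   | yes refl = i₂ , (λ e → i₁≢i₂ (sym e)) , t₂
  ...   | no i₁≢iD = i₁ , i₁≢iD , t₁

  open UniqueTallest (suc k′) cs iD iD-height others (proj₁ second) (proj₁ (proj₂ second)) (proj₂ (proj₂ second)) public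
    using (MainRoot-root; MainRoot-deep)

  low-if-no-mainRoot : ∀ j → ¬ MainRoot (node cs) (sub j root) → height (lookup cs j) ≤ suc k′
  low-if-no-mainRoot j ¬mr with j ≟ᶠ iD
  ... | yes refl = ⊥-elim (¬mr MainRoot-deep)
  ... | no j≢iD  = others j j≢iD

OddShape-Invariant : ∀ k′ {Deep : RTree → Set} → (∀ {c} → Deep c → height c ≡ suc (suc k′)) →
  ≈-Resp Deep → CopyClosed Deep → Invariant k′ (OddShape Deep k′)
OddShape-Invariant k′ {Deep} Deep-height Deep-≈ Deep-copy = record
  { resp-≈   = OddShape-≈ Deep-≈
  ; copyable = copy-below
  ; mainRoot = λ { {node cs} shape → OddShapeRoots.MainRoot-root k′ Deep-height cs shape }
  ; wide     = λ { {node cs} shape → tall (proj₁ shape) }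
  ; low      = λ { {cs} shape → OddShapeRoots.children≤ k′ Deep-height cs shape }
  }
  where
  copy-below : ∀ ctx cs (j : Fin (length cs)) s → (ctx ≡ [] → ¬ MainRoot (node cs) (sub j root)) →
    OddShape Deep k′ (plug ctx cs) → OddShape Deep k′ (plug ctx (replicate s (lookup cs j) ++ cs))
  copy-below [] cs j s ¬mr shape =
    OddShape-copy Deep-copy [] cs j s (λ _ → OddShapeRoots.low-if-no-mainRoot k′ Deep-height cs shape j (¬mr refl)) shape
  copy-below (R ∷ ctx) cs j s _ shape = OddShape-copy Deep-copy (R ∷ ctx) cs j s (λ ()) shape

-- Unfoldings keep the shape of their seed

replicate-cong : ∀ s {a b cs ds} → a ≅ᵣ b → node cs ≅ᵣ node ds →
  node (replicate s a ++ cs) ≅ᵣ node (replicate s b ++ ds)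
replicate-cong zero    f g = g
replicate-cong (suc s) f g = cong-∷ f (replicate-cong s f g)

?∷-shift : ∀ U xs ys → node (xs ++ U ?∷ ys) ≅ node (U ?∷ xs ++ ys)
?∷-shift nothing  xs ys = ≅-refl
?∷-shift (just x) xs ys = ≈*⇒≅ (≈*-shift xs x ys)

heights≤height-plug : ∀ ctx cs → heights cs ≤ height (plug ctx cs)
heights≤height-plug []        cs = ≤-refl
heights≤height-plug (R ∷ ctx) cs = ≤-trans (heights≤height-plug ctx cs) (≤-trans (n≤1+n _) (m≤m⊔n _ (heights R)))

module Forward {k′ : ℕ} {Shape : RTree → Set} (inv : Invariant k′ Shape) where
  open Invariant inv

  Represented : RTree → Set
  Represented T = Σ RTree λ t → Shape t × T ≅ t

  -- Otherwise the root, a main root, would lie in a branch of height at most k, while the tree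
  -- has diameter at least 2k+2.
  root-above-focus : ∀ ctx cs x → ctx ≢ [] → Shape (plug ctx cs) → (z : plug ctx cs ≅ node (x ∷ cs)) →
    to z (inFocus ctx root) ≡ root → Σ (Pos x) λ q → to z root ≡ sub zero q
  root-above-focus [] cs x ctx≢[] _ _ _ = ⊥-elim (ctx≢[] refl)
  root-above-focus (R ∷ ctx) cs x _ shape z z-focus with to z root in z-root
  ... | root = ⊥-elim (sub≢root (≅-injective z (trans z-focus (sym z-root))))
  root-above-focus (R ∷ ctx) cs x _ shape z z-focus | sub zero q = q , refl
  root-above-focus (R ∷ ctx) cs x _ shape z z-focus | sub (suc j) p =
    ⊥-elim (¬MainRoot-low (Far-≅ {suc k′} z (Wide⇒Far (suc k′) _ (wide shape))) (sub (suc j) p) (λ ()) p-low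
            (subst (MainRoot _) z-root (MainRoot-≅ z (mainRoot shape))))
    where
    focus≤ : height (plug ctx cs) ≤ suc (suc k′)
    focus≤ with low shape
    ... | h ∷ _ = h
    p-low : height (subtree (lookup cs j) p) ≤ suc k′
    p-low = ≤-trans (height-subtree (lookup cs j) p)
              (≤-pred (≤-trans (lookup-height cs j) (≤-trans (heights≤height-plug ctx cs) focus≤)))

  module CopyAtFocus {cs} (i : Fin (length cs)) (s : ℕ) (¬mr : NoMainRootIn cs i)
                     {ctx cs′} (shape : Shape (plug ctx cs′))
                     (g : node cs ≅ plug ctx cs′) (g-root : to g root ≡ inFocus ctx root) where

    module _ {U : Maybe RTree} (r : Rerooting ctx cs′ U) where
      open Rerooting r

      h : node cs ≅ node (U ?∷ cs′)
      h = ≅-trans g (reroot cs′)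

      h-root : to h root ≡ root
      h-root = trans (cong (to (reroot cs′)) g-root) reroot-focus

      ¬mainRoot-matched : ∀ {j} (ψ : Pos (lookup (U ?∷ cs′) j) → Pos (lookup cs i)) →
        (∀ q → from h (sub j q) ≡ sub i (ψ q)) → ∀ m → MainRoot (plug ctx cs′) m → ∀ q → to (reroot cs′) m ≢ sub j q
      ¬mainRoot-matched ψ from-ψ m mr q e = ¬mr (ψ q , subst (MainRoot (node cs)) from-m (MainRoot-≅ (≅-sym g) mr))
        where
        from-m : from g m ≡ sub i (ψ q)
        from-m = trans (cong (from g) (trans (sym (from∘to (reroot cs′) m)) (cong (from (reroot cs′)) e))) (from-ψ q)

      copies : ∀ j′ → (∀ m → MainRoot (plug ctx cs′) m → ∀ q → to (reroot cs′) m ≢ subBelow U j′ q) →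
        lookup cs i ≅ᵣ lookup cs′ j′ → Represented (node (replicate s (lookup cs i) ++ cs))
      copies j′ ¬mainRoot c≅ = plug ctx (replicate s (lookup cs′ j′) ++ cs′) ,
        copyable ctx cs′ j′ s no-mainRoot shape ,
        ≅-trans (proj₁ (replicate-cong s c≅ (h , h-root)))
          (≅-trans (?∷-shift U (replicate s (lookup cs′ j′)) cs′)
                   (≅-sym (reroot (replicate s (lookup cs′ j′) ++ cs′))))
        where
        no-mainRoot : ctx ≡ [] → ¬ MainRoot (node cs′) (sub j′ root)
        no-mainRoot refl mr = ¬mainRoot (sub j′ root) mr root (reroot-below j′ root)

    dispatch : ∀ U (r : Rerooting ctx cs′ U) → (ctx ≡ [] → U ≡ nothing) →
      ∀ j (ψ : Pos (lookup (U ?∷ cs′) j) → Pos (lookup cs i)) → (∀ q → from (h r) (sub j q) ≡ sub i (ψ q)) →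
      lookup cs i ≅ᵣ lookup (U ?∷ cs′) j → Represented (node (replicate s (lookup cs i) ++ cs))
    dispatch nothing  r _ j       ψ from-ψ c≅ = copies r j (¬mainRoot-matched r ψ from-ψ) c≅
    dispatch (just x) r _ (suc j) ψ from-ψ c≅ = copies r j (¬mainRoot-matched r ψ from-ψ) c≅
    -- Branch zero at the focus is the one containing the root of the shaped tree, a main root.
    dispatch (just x) r U≡nothing zero ψ from-ψ _
      with root-above-focus ctx cs′ x (λ e → just≢nothing (U≡nothing e)) shape
                            (Rerooting.reroot r cs′) (Rerooting.reroot-focus r)
      where
      just≢nothing : ∀ {A : Set} {a : A} → just a ≢ nothing
      just≢nothing ()
    ... | q , root↦q = ⊥-elim (¬mainRoot-matched r ψ from-ψ root (mainRoot shape) q root↦q)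

    result : Represented (node (replicate s (lookup cs i) ++ cs))
    result = dispatch _ r (λ { refl → refl }) j ψ from-ψ child
      where
      r : Rerooting ctx cs′ (upBranch nothing ctx)
      r = reroot-at-focus ctx cs′
      open ChildMatch (match-child (h r , h-root r) i)

  Unf⇒Represented : ∀ {Sd T} → Shape Sd → Unf Sd T → Represented T
  Unf⇒Represented shape seed = _ , shape , ≅-refl
  Unf⇒Represented shape (iso u f) with Unf⇒Represented shape u
  ... | t , shape′ , g = t , shape′ , ≅-trans (≅-sym f) g
  Unf⇒Represented shape (cbd i s _ u ¬mr) with Unf⇒Represented shape u
  ... | t , shape′ , g with focus-on t (to g root)
  ... | ctx , cs′ , φ , φ-v , t≈ =
    CopyAtFocus.result i s ¬mr (resp-≈ t≈ shape′) (≅-trans g (proj₁ φ)) φ-v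

-- Complete trees are 𝒯* trees

partition : ∀ {A B : RTree → Set} cs → All (λ c → A c ⊎ B c) cs →
  Σ (List RTree) λ lo → Σ (List RTree) λ hi → All A lo × All B hi × cs ≈* lo ++ hi
partition [] [] = [] , [] , [] , [] , []
partition (c ∷ cs) (inj₁ a ∷ abs) with partition cs abs
... | lo , hi , as , bs , l = c ∷ lo , hi , a ∷ as , bs , ≈-refl c ∷ l
partition (c ∷ cs) (inj₂ b ∷ abs) with partition cs abs
... | lo , hi , as , bs , l = lo , c ∷ hi , as , b ∷ bs , ≈*-trans (≈-refl c ∷ l) (≈*-sym (≈*-shift lo c hi))

¬Any∧All : ∀ {P Q : RTree → Set} {xs} → Any P xs → All Q xs → (∀ {c} → P c → Q c → ⊥) → ⊥
¬Any∧All (here p)  (q ∷ _)  ¬pq = ¬pq p q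
¬Any∧All (there a) (_ ∷ qs) ¬pq = ¬Any∧All a qs ¬pq

CoversBelow-low : ∀ {h₀ h₁ cs} lo hi → h₀ ≤ h₁ → cs ≈* lo ++ hi → All (λ c → height c ≡ h₁) hi →
  CoversBelow h₀ cs → CoversBelow h₀ lo
CoversBelow-low {h₀} lo hi h₀≤h₁ l hi≡ cov n n<h₀ with ++⁻ lo (Any-≈* (height-resp (_≡ n)) l (cov n n<h₀))
... | inj₁ in-lo = in-lo
... | inj₂ in-hi = ⊥-elim (¬Any∧All in-hi hi≡ λ c≡n c≡h₁ →
                     <⇒≢ (≤-trans n<h₀ h₀≤h₁) (trans (sym c≡n) c≡h₁))

heights-covered : ∀ h lo → All (λ c → height c < h) lo → CoversBelow h lo → heights lo ≡ h
heights-covered zero    lo lo<h _   = n≤0⇒n≡0 (heights≤ lo lo<h)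
heights-covered (suc h) lo lo<h cov = ≤-antisym (heights≤ lo lo<h)
  (subst (λ n → suc n ≤ heights lo) (lookup-index (cov h ≤-refl)) (lookup-height lo (Any.index (cov h ≤-refl))))

Complete-covered : ∀ h lo → All (λ c → Complete c × height c < h) lo → CoversBelow h lo →
  Complete (node lo) × heights lo ≡ h
Complete-covered h lo lo∈ cov = node (All.map proj₁ lo∈) (subst (λ n → CoversBelow n lo) (sym lo-heights) cov) , lo-heights
  where
  lo-heights : heights lo ≡ h
  lo-heights = heights-covered h lo (All.map proj₂ lo∈) cov

CoversBelow⇒tall : ∀ h cs → CoversBelow (suc h) cs → 1 ≤ countTall h cs
CoversBelow⇒tall h cs cov =
  countTall-one h cs (Any.index (cov h ≤-refl)) (≤-reflexive (sym (lookup-index (cov h ≤-refl))))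

TStar⁺ : ℕ → RTree → Set
TStar⁺ h t = TStar t × height t ≡ h × MainRoot t root

record Split (h₀ h₁ n : ℕ) (cs : List RTree) : Set where
  constructor split
  field
    cs₀   : List RTree
    ts    : List RTree
    T₀∈   : TStar⁺ h₀ (node cs₀)
    ts∈   : All (TStar⁺ h₁) ts
    many  : n ≤ length ts
    perm  : cs ≈* cs₀ ++ ts

Complete⇒TStar : ∀ h t → Complete t → height t ≡ h → Σ RTree λ t′ → TStar⁺ h t′ × t ≈ t′
Complete*⇒TStar : ∀ h cs → All (λ c → Complete c × height c ≡ h) cs →
  Σ (List RTree) λ ts → All (TStar⁺ h) ts × cs ≈* ts
splitting : ∀ h₀ h₁ n cs → h₀ ≤ h₁ → All (λ c → Complete c × (height c < h₀ ⊎ height c ≡ h₁)) cs →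
  CoversBelow h₀ cs → n ≤ countTall h₁ cs → Split h₀ h₁ n cs

Complete⇒TStar zero (node []) _ _ = K1 , (base , refl , Complete-MainRoot (node [] (λ _ ()))) , ≈-refl _
Complete⇒TStar zero (node (c ∷ cs)) _ e =
  ⊥-elim (1+n≢0 (n≤0⇒n≡0 (subst (suc (height c) ≤_) e (m≤m⊔n _ (heights cs)))))
Complete⇒TStar (suc h) (node cs) (node cs∈ cov) e
  with splitting h h 1 cs ≤-refl (All.zipWith classify (cs∈ , heights≤⁻ cs (≤-reflexive e)))
                 (λ n n<h → cov′ n (≤-trans n<h (n≤1+n h))) (CoversBelow⇒tall h cs cov′)
  where
  cov′ : CoversBelow (suc h) cs
  cov′ = subst (λ m → CoversBelow m cs) e cov
  classify : ∀ {c} → Complete c × height c < suc h → Complete c × (height c < h ⊎ height c ≡ h)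
  classify (c∈ , c<) = c∈ , m≤n⇒m<n∨m≡n (≤-pred c<)
... | split cs₀ ts (T₀∈ , T₀-height , T₀-mainRoot) ts∈ one≤ l =
  node cs₀ ⊙ ts ,
  (step h (node cs₀) ts T₀∈ T₀-height T₀-mainRoot ts∈ one≤ ,
   height-⊙ cs₀ ts T₀-height (All.map (λ t∈ → proj₁ (proj₂ t∈)) ts∈) one≤ ,
   Complete-MainRoot (Complete-≈ (node l) (node cs∈ cov))) ,
  node l
Complete*⇒TStar h [] [] = [] , [] , []
Complete*⇒TStar h (c ∷ cs) ((c∈ , c-height) ∷ cs∈) with Complete⇒TStar h c c∈ c-height | Complete*⇒TStar h cs cs∈
... | t , t∈ , c≈t | ts , ts∈ , l = t ∷ ts , t∈ ∷ ts∈ , c≈t ∷ l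
splitting h₀ h₁ n cs h₀≤h₁ cs∈ cov n≤ with partition cs (All.map distribute cs∈)
  where
  distribute : ∀ {c} → Complete c × (height c < h₀ ⊎ height c ≡ h₁) →
    (Complete c × height c < h₀) ⊎ (Complete c × height c ≡ h₁)
  distribute (c∈ , inj₁ c<) = inj₁ (c∈ , c<)
  distribute (c∈ , inj₂ c≡) = inj₂ (c∈ , c≡)
... | lo , hi , lo∈ , hi∈ , l
  with Complete-covered h₀ lo lo∈ (CoversBelow-low lo hi h₀≤h₁ l (All.map proj₂ hi∈) cov)
... | lo-complete , lo-heights with Complete⇒TStar h₀ (node lo) lo-complete lo-heights
... | node cs₀ , T₀∈ , node l₀ with Complete*⇒TStar h₁ hi hi∈
... | ts , ts∈ , l₁ = split cs₀ ts T₀∈ ts∈ many (≈*-trans l (≈*-++ l₀ l₁))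
  where
  open ≤-Reasoning
  many : n ≤ length ts
  many = begin
    n                                   ≤⟨ n≤ ⟩
    countTall h₁ cs                      ≡⟨ countTall-≈* h₁ l ⟩
    countTall h₁ (lo ++ hi)              ≡⟨ countTall-++ h₁ lo hi ⟩
    countTall h₁ lo + countTall h₁ hi    ≡⟨ cong (_+ countTall h₁ hi)
                                              (countTall-low h₁ lo (All.map (λ c∈ → ≤-trans (proj₂ c∈) h₀≤h₁) lo∈)) ⟩
    countTall h₁ hi                      ≤⟨ countTall≤length h₁ hi ⟩
    length hi                            ≡⟨ ≈*-length l₁ ⟩
    length ts                            ∎

-- The right-hand sides of (i), and of (ii) and (iii) with h₀′ = k − 1 and h₀′ = k respectively.
EvenForm : ℕ → RTree → Set
EvenForm k T = Σ RTree λ T₀ → Σ (List RTree) λ ts →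
  TStarH (k ∸ 1) T₀ × All (TStarH k) ts × 2 ≤ length ts × T ≅ (T₀ ⊙ ts)

OddForm : ℕ → ℕ → RTree → Set
OddForm h₀′ k T = Σ RTree λ T₀ → Σ (List RTree) λ ts → Σ RTree λ T₀′ → Σ (List RTree) λ ts′ →
  TStarH (k ∸ 1) T₀ × All (TStarH k) ts × 1 ≤ length ts ×
  TStarH h₀′ T₀′ × All (TStarH k) ts′ × 1 ≤ length ts′ × T ≅ ((T₀ ⊙ ts) ⊙ [ T₀′ ⊙ ts′ ])

TStar⁺⇒TStarH : ∀ {h t} → TStar⁺ h t → TStarH h t
TStar⁺⇒TStarH (t∈ , t-height , _) = t∈ , t-height

EvenShape⇒EvenForm : ∀ k′ cs → EvenShape k′ (node cs) → EvenForm (suc k′) (node cs)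
EvenShape⇒EvenForm k′ cs (profile sides cov two) with splitting k′ (suc k′) 2 cs (n≤1+n k′) sides cov two
... | split cs₀ ts T₀∈ ts∈ many l =
  node cs₀ , ts , TStar⁺⇒TStarH T₀∈ , All.map TStar⁺⇒TStarH ts∈ , many , ≈*⇒≅ l

Splits : (RTree → Set) → ℕ → ℕ → Set
Splits Deep h₀′ k′ = ∀ {ds} → Deep (node ds) → Split h₀′ (suc k′) 1 ds

DeepS′-splits : ∀ k′ → Splits (DeepS′ k′) k′ k′
DeepS′-splits k′ (_ , profile sides cov one) = splitting k′ (suc k′) 1 _ (n≤1+n k′) sides cov one

DeepS″-splits : ∀ k′ → Splits (DeepS″ k′) (suc k′) k′
DeepS″-splits k′ (_ , profile lows cov one) =
  splitting (suc k′) (suc k′) 1 _ ≤-refl (All.map (λ (c∈ , c≤) → c∈ , m≤n⇒m<n∨m≡n c≤) lows) cov one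

one-deep-child : ∀ k′ {Deep : RTree → Set} → (∀ {c} → Deep c → height c ≡ suc (suc k′)) → ∀ {cs} lo hi →
  All (Side k′) lo → All Deep hi → cs ≈* lo ++ hi → countTall (suc (suc k′)) cs ≡ 1 → length hi ≡ 1
one-deep-child k′ Deep-height {cs} lo hi sides deeps l one = begin
  length hi                         ≡⟨ sym (countTall-all-tall K hi (All.map (λ d → ≤-reflexive (sym (Deep-height d))) deeps)) ⟩
  countTall K hi                    ≡⟨ cong (_+ countTall K hi) (sym (countTall-low K lo (All.map (s≤s ∘ Side-height) sides))) ⟩
  countTall K lo + countTall K hi   ≡⟨ sym (countTall-++ K lo hi) ⟩
  countTall K (lo ++ hi)            ≡⟨ sym (countTall-≈* K l) ⟩
  countTall K cs                    ≡⟨ one ⟩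
  1                                 ∎
  where
  open ≡-Reasoning
  K : ℕ
  K = suc (suc k′)

OddShape⇒OddForm : ∀ k′ {Deep h₀′} → (∀ {c} → Deep c → height c ≡ suc (suc k′)) → Splits Deep h₀′ k′ →
  ∀ cs → OddShape Deep k′ (node cs) → OddForm h₀′ (suc k′) (node cs)
OddShape⇒OddForm k′ {Deep} {h₀′} Deep-height Deep-splits cs (profile children∈ cov two , one)
  with partition cs children∈
... | lo , hi , sides , deeps , l = single hi deeps l (one-deep-child k′ Deep-height lo hi sides deeps l one)
  where
  single : ∀ hi → All Deep hi → cs ≈* lo ++ hi → length hi ≡ 1 → OddForm h₀′ (suc k′) (node cs)
  single (node ds ∷ []) (deep ∷ []) l _
    with Deep-splits deep | splitting k′ (suc k′) 1 lo (n≤1+n k′) sides lo-cov lo-tall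
    where
    open ≡-Reasoning
    lo-cov : CoversBelow k′ lo
    lo-cov = CoversBelow-low lo [ node ds ] (≤-trans (n≤1+n k′) (n≤1+n _)) l (Deep-height deep ∷ []) cov
    lo-tall : 1 ≤ countTall (suc k′) lo
    lo-tall = +-cancelʳ-≤ 1 1 _ (≤-trans two (≤-reflexive (begin
      countTall (suc k′) cs                                ≡⟨ countTall-≈* (suc k′) l ⟩
      countTall (suc k′) (lo ++ [ node ds ])               ≡⟨ countTall-++ (suc k′) lo _ ⟩
      countTall (suc k′) lo + countTall (suc k′) [ node ds ] ≡⟨ cong (countTall (suc k′) lo +_)
           (countTall-all-tall (suc k′) [ node ds ] (≤-trans (n≤1+n _) (≤-reflexive (sym (Deep-height deep))) ∷ [])) ⟩
      countTall (suc k′) lo + 1                            ∎)))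
  ... | split cs₀′ ts′ T₀′∈ ts′∈ many′ l′ | split cs₀ ts T₀∈ ts∈ many l₀ =
    node cs₀ , ts , node cs₀′ , ts′ ,
    TStar⁺⇒TStarH T₀∈ , All.map TStar⁺⇒TStarH ts∈ , many ,
    TStar⁺⇒TStarH T₀′∈ , All.map TStar⁺⇒TStarH ts′∈ , many′ ,
    ≈*⇒≅ (≈*-trans l (≈*-++ l₀ (node l′ ∷ [])))

-- The seeds have their shapes

minChildren-covers : ∀ h → CoversBelow h (minChildren h)
minChildren-covers (suc h) l l<h with m≤n⇒m<n∨m≡n (≤-pred l<h)
... | inj₁ l<h′  = ++⁺ˡ (minChildren-covers h l l<h′)
... | inj₂ refl  = ++⁺ʳ (minChildren h) (here (minTree-height l))

minChildren-complete : ∀ h → All Complete (minChildren h)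
minTree-complete : ∀ h → Complete (minTree h)
minChildren-complete zero    = []
minChildren-complete (suc h) = ++⁺ (minChildren-complete h) (minTree-complete h ∷ [])
minTree-complete h =
  node (minChildren-complete h) (subst (λ n → CoversBelow n (minChildren h)) (sym (minTree-height h)) (minChildren-covers h))

minChildren-low : ∀ h → All (λ c → height c < h) (minChildren h)
minChildren-low h = heights≤⁻ (minChildren h) (≤-reflexive (minTree-height h))

Profile-min : ∀ {G lev top n} h extra → (∀ {c} → Complete c → height c < h → G c) → All G extra → lev ≤ h →
  n ≤ countTall top extra → Profile G lev top n (minChildren h ++ extra)
Profile-min {top = top} h extra low⇒G extra∈ lev≤h n≤ =
  profile (++⁺ (All.zipWith (λ (c∈ , c<h) → low⇒G c∈ c<h) (minChildren-complete h , minChildren-low h)) extra∈)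
          (λ l l<lev → ++⁺ˡ (minChildren-covers h l (≤-trans l<lev lev≤h)))
          (≤-trans n≤ (countTall-++ˡ top (minChildren h) extra))

module SeedShapes (k′ : ℕ) where

  K : ℕ
  K = suc (suc k′)

  mk : RTree
  mk = minTree (suc k′)

  mk-side : Side k′ mk
  mk-side = minTree-complete (suc k′) , inj₂ (minTree-height (suc k′))

  two-tall : ∀ a b → suc k′ ≤ height a → suc k′ ≤ height b → 2 ≤ countTall (suc k′) (a ∷ b ∷ [])
  two-tall a b ta tb = ≤-reflexive (sym (countTall-all-tall (suc k′) (a ∷ b ∷ []) (ta ∷ tb ∷ [])))

  one-tall : 1 ≤ countTall (suc k′) [ mk ]
  one-tall = ≤-reflexive (sym (countTall-all-tall (suc k′) [ mk ] (minTree-tall (suc k′) ∷ [])))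

  EvenShape-seed : EvenShape k′ (S'ᵉ (suc k′))
  EvenShape-seed = subst (EvenShape k′) (sym (seed-S′-even k′))
    (Profile-min k′ (mk ∷ mk ∷ []) (λ c∈ c< → c∈ , inj₁ c<) (mk-side ∷ mk-side ∷ []) ≤-refl
                 (two-tall mk mk (minTree-tall (suc k′)) (minTree-tall (suc k′))))

  OddShape-root : ∀ {Deep} D → Deep D → height D ≡ K → OddShape Deep k′ (node ((minChildren k′ ++ [ mk ]) ++ [ D ]))
  OddShape-root {Deep} D deep D-height =
    subst (OddShape Deep k′) (cong node (sym (++-assoc (minChildren k′) [ mk ] [ D ])))
      (Profile-min k′ (mk ∷ D ∷ []) (λ c∈ c< → inj₁ (c∈ , inj₁ c<)) (inj₁ mk-side ∷ inj₂ deep ∷ []) ≤-refl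
                   (two-tall mk D (minTree-tall (suc k′)) (≤-trans (n≤1+n _) D-tall)) ,
       trans (cong (countTall K) (sym (++-assoc (minChildren k′) [ mk ] [ D ]))) one-deep)
    where
    D-tall : K ≤ height D
    D-tall = ≤-reflexive (sym D-height)
    low : All (λ c → height c < K) (minChildren k′ ++ [ mk ])
    low = ++⁺ (All.map (λ c< → ≤-trans c< (≤-trans (n≤1+n _) (n≤1+n _))) (minChildren-low k′))
              (≤-reflexive (cong suc (minTree-height (suc k′))) ∷ [])
    one-deep : countTall K ((minChildren k′ ++ [ mk ]) ++ [ D ]) ≡ 1
    one-deep = trans (countTall-++ K (minChildren k′ ++ [ mk ]) [ D ])
                     (cong₂ _+_ (countTall-low K (minChildren k′ ++ [ mk ]) low) (countTall-all-tall K [ D ] (D-tall ∷ [])))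

  OddShape-seed′ : OddShape (DeepS′ k′) k′ (S'ᵒ (suc k′))
  OddShape-seed′ = subst (OddShape (DeepS′ k′) k′) (sym (seed-S′-odd k′))
    (OddShape-root D₀ (D₀-height , Profile-min k′ [ mk ] (λ c∈ c< → c∈ , inj₁ c<) (mk-side ∷ []) ≤-refl one-tall)
                      D₀-height)
    where
    D₀ : RTree
    D₀ = minTree k′ ⊙ [ mk ]
    D₀-height : height D₀ ≡ K
    D₀-height = trans (heights-++ (minChildren k′) [ mk ])
      (trans (cong₂ _⊔_ (minTree-height k′) (trans (⊔-identityʳ _) (cong suc (minTree-height (suc k′)))))
             (m≤n⇒m⊔n≡n (≤-trans (n≤1+n _) (n≤1+n _))))

  OddShape-seed″ : OddShape (DeepS″ k′) k′ (S''ᵒ (suc k′))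
  OddShape-seed″ = subst (OddShape (DeepS″ k′) k′) (sym (seed-S″-odd k′))
    (OddShape-root (minTree K)
      (minTree-height K , Profile-min (suc k′) [ mk ] (λ c∈ c< → c∈ , <⇒≤ c<)
                             ((minTree-complete (suc k′) , ≤-reflexive (minTree-height (suc k′))) ∷ []) ≤-refl one-tall)
      (minTree-height K))

EvenForm-≅ : ∀ {k T T′} → T ≅ T′ → EvenForm k T′ → EvenForm k T
EvenForm-≅ f (T₀ , ts , T₀∈ , ts∈ , many , g) = T₀ , ts , T₀∈ , ts∈ , many , ≅-trans f g

OddForm-≅ : ∀ {h₀′ k T T′} → T ≅ T′ → OddForm h₀′ k T′ → OddForm h₀′ k T
OddForm-≅ f (T₀ , ts , T₀′ , ts′ , T₀∈ , ts∈ , many , T₀′∈ , ts′∈ , many′ , g) =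
  T₀ , ts , T₀′ , ts′ , T₀∈ , ts∈ , many , T₀′∈ , ts′∈ , many′ , ≅-trans f g

S′-even-forward : ∀ k′ {T} → Unf (S'ᵉ (suc k′)) T → EvenForm (suc k′) T
S′-even-forward k′ u with Forward.Unf⇒Represented (EvenShape-Invariant k′) (SeedShapes.EvenShape-seed k′) u
... | node cs , shape , g = EvenForm-≅ g (EvenShape⇒EvenForm k′ cs shape)

S′-even-backward : ∀ k′ {T} → EvenForm (suc k′) T → Unf (S'ᵉ (suc k′)) T
S′-even-backward k′ (node cs₀ , ts , T₀∈ , ts∈ , many , f) = unfold-S′-even k′ T₀∈ ts∈ many f

S′-odd-forward : ∀ k′ {T} → Unf (S'ᵒ (suc k′)) T → OddForm k′ (suc k′) T
S′-odd-forward k′ u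
  with Forward.Unf⇒Represented (OddShape-Invariant k′ proj₁ DeepS′-≈ DeepS′-copy) (SeedShapes.OddShape-seed′ k′) u
... | node cs , shape , g = OddForm-≅ g (OddShape⇒OddForm k′ proj₁ (DeepS′-splits k′) cs shape)

S′-odd-backward : ∀ k′ {T} → OddForm k′ (suc k′) T → Unf (S'ᵒ (suc k′)) T
S′-odd-backward k′ (node cs₀ , ts , node cs₀′ , ts′ , T₀∈ , ts∈ , many , T₀′∈ , ts′∈ , many′ , f) =
  unfold-S′-odd k′ T₀∈ ts∈ many T₀′∈ ts′∈ many′ f

S″-odd-forward : ∀ k′ {T} → Unf (S''ᵒ (suc k′)) T → OddForm (suc k′) (suc k′) T
S″-odd-forward k′ u
  with Forward.Unf⇒Represented (OddShape-Invariant k′ proj₁ DeepS″-≈ DeepS″-copy) (SeedShapes.OddShape-seed″ k′) u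
... | node cs , shape , g = OddForm-≅ g (OddShape⇒OddForm k′ proj₁ (DeepS″-splits k′) cs shape)

S″-odd-backward : ∀ k′ {T} → OddForm (suc k′) (suc k′) T → Unf (S''ᵒ (suc k′)) T
S″-odd-backward k′ (node cs₀ , ts , node cs₀′ , ts′ , T₀∈ , ts∈ , many , T₀′∈ , ts′∈ , many′ , f) =
  unfold-S″-odd k′ T₀∈ ts∈ many T₀′∈ ts′∈ many′ f

proposition3p5 : ∀ (T : RTree) (k : ℕ) → 1 ≤ k →
    let k-1 = k ∸ 1 in
    ((Unf (S'ᵉ k) T →
        Σ RTree λ T₀ → Σ (List RTree) λ ts →
          TStarH k-1 T₀ × All (TStarH k) ts × 2 ≤ length ts × T ≅ (T₀ ⊙ ts))
    × ((Σ RTree λ T₀ → Σ (List RTree) λ ts →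
          TStarH k-1 T₀ × All (TStarH k) ts × 2 ≤ length ts × T ≅ (T₀ ⊙ ts))
        → Unf (S'ᵉ k) T))
  × ((Unf (S'ᵒ k) T →
        Σ RTree λ T₀ → Σ (List RTree) λ ts → Σ RTree λ T₀' → Σ (List RTree) λ ts' →
          TStarH k-1 T₀ × All (TStarH k) ts × 1 ≤ length ts
          × TStarH k-1 T₀' × All (TStarH k) ts' × 1 ≤ length ts'
          × T ≅ ((T₀ ⊙ ts) ⊙ ((T₀' ⊙ ts') ∷ [])))
    × ((Σ RTree λ T₀ → Σ (List RTree) λ ts → Σ RTree λ T₀' → Σ (List RTree) λ ts' →
          TStarH k-1 T₀ × All (TStarH k) ts × 1 ≤ length ts
          × TStarH k-1 T₀' × All (TStarH k) ts' × 1 ≤ length ts'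
          × T ≅ ((T₀ ⊙ ts) ⊙ ((T₀' ⊙ ts') ∷ [])))
        → Unf (S'ᵒ k) T))
  × ((Unf (S''ᵒ k) T →
        Σ RTree λ T₀ → Σ (List RTree) λ ts → Σ RTree λ T₀' → Σ (List RTree) λ ts' →
          TStarH k-1 T₀ × All (TStarH k) ts × 1 ≤ length ts
          × TStarH k T₀' × All (TStarH k) ts' × 1 ≤ length ts'
          × T ≅ ((T₀ ⊙ ts) ⊙ ((T₀' ⊙ ts') ∷ [])))
    × ((Σ RTree λ T₀ → Σ (List RTree) λ ts → Σ RTree λ T₀' → Σ (List RTree) λ ts' →
          TStarH k-1 T₀ × All (TStarH k) ts × 1 ≤ length ts
          × TStarH k T₀' × All (TStarH k) ts' × 1 ≤ length ts'
          × T ≅ ((T₀ ⊙ ts) ⊙ ((T₀' ⊙ ts') ∷ [])))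
        → Unf (S''ᵒ k) T))
proposition3p5 T (suc k′) _ =
  (S′-even-forward k′ , S′-even-backward k′) ,
  (S′-odd-forward k′ , S′-odd-backward k′) ,
  (S″-odd-forward k′ , S″-odd-backward k′)
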